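{- If $G$ is a connected graph of order $n\geqslant 3$ and $k$ is a natural number, then $D(G^{\frac{1}{2k}})=D''(G^{\frac{1}{k}})$.
   Context: Graphs are finite and simple. The $k$-subdivision $G^{\frac{1}{k}}$ is obtained by replacing each edge $uv$ of $G$ by a path of length $k$ between $u$ and $v$ with $k-1$ new internal vertices. The distinguishing number $D(H)$ is the least $d$ such that some labeling $V(H)\to\{1,\dots,d\}$ is preserved by no non-trivial automorphism of $H$. The total distinguishing number $D''(H)$ is the least $d$ such that there is a labeling $V(H)\cup E(H)\to\{1,\dots,d\}$ (a total colouring, not necessarily proper) preserved only by the identity automorphism of $H$ (an automorphism acts on edges via its action on vertices). -}

module Defs where

open import Data.Nat using (ℕ; zero; suc; _+_; _∸_; _<_; _≡ᵇ_; _<ᵇ_)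
open import Data.Fin using (Fin; toℕ)
open import Data.Bool using (Bool; true; false; _∧_; _∨_; T)
open import Data.Sum using (_⊎_; inj₁; inj₂)
open import Data.Product using (Σ; _×_; _,_)
open import Relation.Binary.PropositionalEquality using (_≡_)
open import Relation.Nullary using (¬_)

record SimpleGraph (n : ℕ) : Set where
  field
    adj    : Fin n → Fin n → Bool
    sym    : ∀ u v → adj u v ≡ adj v u
    irrefl : ∀ v → adj v v ≡ false

-- A general graph: an arbitrary vertex type with Boolean adjacency.
-- (Used for subdivisions, whose vertex type is not literally Fin N.)
record Graph : Set₁ where
  field
    V   : Set
    adj : V → V → Bool

open Graph public

data Reachable {n : ℕ} (G : SimpleGraph n) : Fin n → Fin n → Set where
  here : ∀ {v} → Reachable G v v
  step : ∀ {u w v} → SimpleGraph.adj G u w ≡ true → Reachable G w v → Reachable G u v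

Connected : ∀ {n} → SimpleGraph n → Set
Connected {n} G = ∀ (u v : Fin n) → Reachable G u v

_==ᶠ_ : ∀ {n} → Fin n → Fin n → Bool
a ==ᶠ b = toℕ a ≡ᵇ toℕ b

-- Is {u,v} an edge, recorded with u < v (each undirected edge once).
EdgeLt : ∀ {n} → SimpleGraph n → Fin n → Fin n → Bool
EdgeLt G u v = SimpleGraph.adj G u v ∧ (toℕ u <ᵇ toℕ v)

-- Internal vertices of the k-subdivision: (u , v , i) with u < v an edge and
-- i : Fin (k ∸ 1); it stands for the (i+1)-th vertex of the path u = x₀,…,x_k = v.
Internal : ∀ {n} → SimpleGraph n → ℕ → Set
Internal {n} G k = Σ (Fin n × Fin n × Fin (k ∸ 1)) λ { (u , v , _) → T (EdgeLt G u v) }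

-- k-subdivision G^{1/k} (meaningful for k ≥ 1): each edge uv is replaced by
-- a path of length k with k-1 new internal vertices.
subdivision : ∀ {n} → ℕ → SimpleGraph n → Graph
subdivision {n} k G = record { V = Fin n ⊎ Internal G k ; adj = A }
  where
  A : Fin n ⊎ Internal G k → Fin n ⊎ Internal G k → Bool
  A (inj₁ a) (inj₁ b) = SimpleGraph.adj G a b ∧ (k ≡ᵇ 1)
  A (inj₁ a) (inj₂ ((u , v , i) , _)) =
    ((a ==ᶠ u) ∧ (toℕ i ≡ᵇ 0)) ∨ ((a ==ᶠ v) ∧ (toℕ i + 2 ≡ᵇ k))
  A (inj₂ ((u , v , i) , _)) (inj₁ a) =
    ((a ==ᶠ u) ∧ (toℕ i ≡ᵇ 0)) ∨ ((a ==ᶠ v) ∧ (toℕ i + 2 ≡ᵇ k))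
  A (inj₂ ((u , v , i) , _)) (inj₂ ((u' , v' , j) , _)) =
    (u ==ᶠ u') ∧ (v ==ᶠ v') ∧ ((suc (toℕ i) ≡ᵇ toℕ j) ∨ (suc (toℕ j) ≡ᵇ toℕ i))

record Aut (H : Graph) : Set where
  field
    σ     : V H → V H
    σ⁻¹   : V H → V H
    left  : ∀ x → σ⁻¹ (σ x) ≡ x
    right : ∀ x → σ (σ⁻¹ x) ≡ x
    pres  : ∀ x y → adj H (σ x) (σ y) ≡ adj H x y

open Aut public

HasDistinguishingLabeling : Graph → ℕ → Set
HasDistinguishingLabeling H d =
  Σ (V H → Fin d) λ c →
    ∀ (φ : Aut H) → (∀ x → c (σ φ x) ≡ c x) → ∀ x → σ φ x ≡ x

IsDistinguishingNumber : Graph → ℕ → Set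
IsDistinguishingNumber H d =
  HasDistinguishingLabeling H d × (∀ d' → d' < d → ¬ HasDistinguishingLabeling H d')

-- A total labeling with d labels (vertex labels cV, edge labels cE given as a
-- symmetric function on vertex pairs, relevant only on edges) preserved only by
-- the identity automorphism.
HasTotalDistinguishingLabeling : Graph → ℕ → Set
HasTotalDistinguishingLabeling H d =
  Σ (V H → Fin d) λ cV →
  Σ (V H → V H → Fin d) λ cE →
    (∀ x y → cE x y ≡ cE y x) ×
    (∀ (φ : Aut H) →
       (∀ x → cV (σ φ x) ≡ cV x) →
       (∀ x y → adj H x y ≡ true → cE (σ φ x) (σ φ y) ≡ cE x y) →
       ∀ x → σ φ x ≡ x)

IsTotalDistinguishingNumber : Graph → ℕ → Set
IsTotalDistinguishingNumber H d =
  HasTotalDistinguishingLabeling H d × (∀ d' → d' < d → ¬ HasTotalDistinguishingLabeling H d')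

-- Write H = G^{1/k} and S = G^{1/2k}; S is H with every edge subdivided once more.
-- A labeling of S yields a total labeling of H (an edge takes the label of its
-- subdivision vertex), and every automorphism of H extends to S; hence D''(H) ≤ D(S).
-- If some vertex of G does not have degree two, automorphisms of S cannot swap branch
-- and subdivision vertices, so they restrict to H and a total labeling of H transfers
-- back to S: D(S) ≤ D''(H).  Otherwise G is a cycle, S is a cycle of length at least six
-- and both numbers are 2: two labels distinguish S, while rotating S by two steps
-- restricts to a non-trivial automorphism of H.

module Submission where

open import Defs
open import Axiom.UniquenessOfIdentityProofs using (module Decidable⇒UIP)
open import Data.Bool using (Bool; true; false; not; if_then_else_; _∧_; _∨_; T)
open import Data.Bool.Properties
  using (⇔→≡; not-injective; not-¬; not-involutive; T-irrelevant; T-≡; ∨-comm) renaming (_≟_ to _≟ᵇ_)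
open import Data.Empty using (⊥; ⊥-elim)
open import Data.Fin using (Fin; zero; suc; toℕ; fromℕ<)
open import Data.Fin.Properties
  using (toℕ-injective; toℕ-fromℕ<; toℕ<n; any?; all?; ¬∀⟶∃¬) renaming (_≟_ to _≟ᶠ_)
open import Data.Nat using (ℕ; zero; suc; _*_; _∸_; _<_; _≤_; _≡ᵇ_; _<ᵇ_; z≤n; s≤s; _<?_; ⌊_/2⌋)
open import Data.Product using (Σ; ∃; _×_; _,_; proj₁; proj₂; map₂)
open import Data.Sum using (_⊎_; inj₁; inj₂) renaming (map to ⊎-map)
open import Data.Unit using (tt)
open import Function.Bundles using (_⇔_; mk⇔; Equivalence)
open import Relation.Binary.Construct.Closure.ReflexiveTransitive using (Star; ε; _◅_; _◅◅_; reverse)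
open import Relation.Binary.Definitions using (DecidableEquality)
open import Relation.Binary.PropositionalEquality
open import Relation.Nullary using (¬_; Dec; yes; no)
open import Relation.Nullary.Decidable using (¬?; _×-dec_; _⊎-dec_; _→-dec_)

Adjacent : (H : Graph) → V H → V H → Set
Adjacent H x y = adj H x y ≡ true

module _ {H : Graph} where

  σ-injective : (φ : Aut H) → ∀ {x y} → σ φ x ≡ σ φ y → x ≡ y
  σ-injective φ {x} {y} e = trans (sym (left φ x)) (trans (cong (σ⁻¹ φ) e) (left φ y))

  σ≡⇒σ⁻¹≡ : (φ : Aut H) → ∀ {x y} → σ φ x ≡ y → σ⁻¹ φ y ≡ x
  σ≡⇒σ⁻¹≡ φ {x} e = trans (cong (σ⁻¹ φ) (sym e)) (left φ x)

  σ-adjacent : (φ : Aut H) → ∀ {x y} → Adjacent H x y → Adjacent H (σ φ x) (σ φ y)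
  σ-adjacent φ {x} {y} e = trans (pres φ x y) e

  σ-adjacent⁻ : (φ : Aut H) → ∀ {x y} → Adjacent H (σ φ x) (σ φ y) → Adjacent H x y
  σ-adjacent⁻ φ {x} {y} e = trans (sym (pres φ x y)) e

  mkAut : (f g : V H → V H) → (∀ x → g (f x) ≡ x) → (∀ x → f (g x) ≡ x) →
          (∀ {x y} → Adjacent H x y → Adjacent H (f x) (f y)) →
          (∀ {x y} → Adjacent H x y → Adjacent H (g x) (g y)) → Aut H
  mkAut f g gf fg f-adj g-adj = record
    { σ = f ; σ⁻¹ = g ; left = gf ; right = fg
    ; pres = λ x y → ⇔→≡ (mk⇔ (λ e → subst₂ (Adjacent H) (gf x) (gf y) (g-adj e)) f-adj) }

  _⁻¹ᴬ : Aut H → Aut H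
  φ ⁻¹ᴬ = record
    { σ = σ⁻¹ φ ; σ⁻¹ = σ φ ; left = right φ ; right = left φ
    ; pres = λ x y → trans (sym (pres φ (σ⁻¹ φ x) (σ⁻¹ φ y))) (cong₂ (adj H) (right φ x) (right φ y)) }

  _∘ᴬ_ : Aut H → Aut H → Aut H
  φ ∘ᴬ ψ = record
    { σ = λ x → σ φ (σ ψ x) ; σ⁻¹ = λ x → σ⁻¹ ψ (σ⁻¹ φ x)
    ; left = λ x → trans (cong (σ⁻¹ ψ) (left φ (σ ψ x))) (left ψ x)
    ; right = λ x → trans (cong (σ φ) (right ψ (σ⁻¹ φ x))) (right φ x)
    ; pres = λ x y → trans (pres φ (σ ψ x) (σ ψ y)) (pres ψ x y) }

bit : ∀ {P : Set} → Dec P → Fin 2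
bit (yes _) = suc zero
bit (no _)  = zero

bit-reflects : ∀ {P Q : Set} (p : Dec P) (q : Dec Q) → bit p ≡ bit q → P → Q
bit-reflects _        (yes q) _ _ = q
bit-reflects (no ¬p)  (no _)  _ p = ⊥-elim (¬p p)

module Undirected (H : Graph)
  (adj-sym : ∀ x y → adj H x y ≡ adj H y x) (adj-irrefl : ∀ x → adj H x x ≡ false) where

  infix 4 _~_
  _~_ : V H → V H → Set
  _~_ = Adjacent H

  ~-sym : ∀ {x y} → x ~ y → y ~ x
  ~-sym {x} {y} e = trans (adj-sym y x) e

  ~⇒≢ : ∀ {x y} → x ~ y → x ≢ y
  ~⇒≢ {x} e refl with trans (sym e) (adj-irrefl x)
  ... | ()

  record DegreeTwo (s : V H) : Set where
    field
      nbr₁ nbr₂ : V H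
      nbr₁≢nbr₂ : nbr₁ ≢ nbr₂
      ~nbr₁     : s ~ nbr₁
      ~nbr₂     : s ~ nbr₂
      only      : ∀ w → s ~ w → w ≡ nbr₁ ⊎ w ≡ nbr₂

  open DegreeTwo

  DegreeTwo-cover : ∀ {s} → DegreeTwo s → ∀ {y z} → y ≢ z → s ~ y → s ~ z →
                    ∀ w → s ~ w → w ≡ y ⊎ w ≡ z
  DegreeTwo-cover d {y} {z} y≢z s~y s~z w s~w
    with only d y s~y | only d z s~z | only d w s~w
  ... | inj₁ refl | inj₁ refl | _      = ⊥-elim (y≢z refl)
  ... | inj₂ refl | inj₂ refl | _      = ⊥-elim (y≢z refl)
  ... | inj₁ refl | inj₂ refl | inj₁ e = inj₁ e
  ... | inj₁ refl | inj₂ refl | inj₂ e = inj₂ e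
  ... | inj₂ refl | inj₁ refl | inj₁ e = inj₂ e
  ... | inj₂ refl | inj₁ refl | inj₂ e = inj₁ e

  DegreeTwo-other : ∀ {s} → DegreeTwo s → ∀ {y z y′} → y ≢ z → y′ ≢ z →
                    s ~ y → s ~ z → s ~ y′ → y′ ≡ y
  DegreeTwo-other d y≢z y′≢z s~y s~z s~y′ with DegreeTwo-cover d y≢z s~y s~z _ s~y′
  ... | inj₁ e = e
  ... | inj₂ e = ⊥-elim (y′≢z e)

  DegreeTwo-σ⁻ : (φ : Aut H) → ∀ {s} → DegreeTwo (σ φ s) → DegreeTwo s
  DegreeTwo-σ⁻ φ {s} d = record
    { nbr₁ = σ⁻¹ φ (nbr₁ d) ; nbr₂ = σ⁻¹ φ (nbr₂ d)
    ; nbr₁≢nbr₂ = λ e → nbr₁≢nbr₂ d (trans (sym (right φ _)) (trans (cong (σ φ) e) (right φ _)))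
    ; ~nbr₁ = σ-adjacent⁻ φ (subst (σ φ s ~_) (sym (right φ _)) (~nbr₁ d))
    ; ~nbr₂ = σ-adjacent⁻ φ (subst (σ φ s ~_) (sym (right φ _)) (~nbr₂ d))
    ; only = λ w s~w → ⊎-map (λ e → sym (σ≡⇒σ⁻¹≡ φ e)) (λ e → sym (σ≡⇒σ⁻¹≡ φ e)) (only d (σ φ w) (σ-adjacent φ s~w)) }

  Path : V H → V H → Set
  Path = Star _~_

  path-sym : ∀ {x y} → Path x y → Path y x
  path-sym = reverse ~-sym

  transport : (P : V H → Set) → (∀ {x y} → x ~ y → P x → P y) →
              ∀ {x y} → Path x y → P x → P y
  transport P move ε         p = p
  transport P move (e ◅ es) p = transport P move es (move e p)


  module TwoRegular (_≟_ : DecidableEquality (V H)) (deg2 : ∀ s → DegreeTwo s)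
                    (connected : ∀ x y → Path x y) where

    open import Data.Integer using (ℤ; +_; -[1+_]; 1ℤ; -1ℤ; _+_; _-_; -_) renaming (suc to sucℤ; pred to predℤ)
    open import Data.Integer.Properties using (suc-pred; pred-suc; +-identityʳ)
    open import Data.Integer.Tactic.RingSolver using (solve-∀)

    private
      add-diff : ∀ y x → y ≡ x + (y - x)
      add-diff = solve-∀

      diff-swap : ∀ x y → x - y ≡ - (y - x)
      diff-swap = solve-∀

    ℤ-offset : ∀ x y → (∃ λ d → y ≡ x + + d) ⊎ (∃ λ d → x ≡ y + + d)
    ℤ-offset x y with y - x in eq
    ... | + d      = inj₁ (d , trans (add-diff y x) (cong (λ z → x + z) eq))
    ... | -[1+ d ] = inj₂ (suc d , trans (add-diff x y) (cong (λ z → y + z) (trans (diff-swap x y) (cong -_ eq))))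

    fixes-neighbours : (φ : Aut H) → ∀ {s t} → s ~ t → σ φ s ≡ s → σ φ t ≡ t →
                       ∀ w → s ~ w → σ φ w ≡ w
    fixes-neighbours φ {s} {t} s~t fs ft w s~w with w ≟ t
    ... | yes refl = ft
    ... | no w≢t = DegreeTwo-other (deg2 s) w≢t σw≢t s~w s~t s~σw
      where
      σw≢t : σ φ w ≢ t
      σw≢t e = w≢t (σ-injective φ (trans e (sym ft)))
      s~σw : s ~ σ φ w
      s~σw = subst (_~ σ φ w) fs (σ-adjacent φ s~w)

    fixes-edge⇒fixes-all : (φ : Aut H) → ∀ {x y} → x ~ y → σ φ x ≡ x → σ φ y ≡ y →
                           ∀ s → σ φ s ≡ s
    fixes-edge⇒fixes-all φ {x} {y} x~y fx fy s =
      proj₁ (transport Fixed propagate (connected y s) (fy , fixes-neighbours φ (~-sym x~y) fy fx))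
      where
      Fixed : V H → Set
      Fixed s = σ φ s ≡ s × (∀ w → s ~ w → σ φ w ≡ w)
      propagate : ∀ {u v} → u ~ v → Fixed u → Fixed v
      propagate u~v (fu , nu) = nu _ u~v , fixes-neighbours φ (~-sym u~v) (nu _ u~v) fu

    other : V H → V H → V H
    other p s with p ≟ nbr₁ (deg2 s)
    ... | yes _ = nbr₂ (deg2 s)
    ... | no _  = nbr₁ (deg2 s)

    ~other : ∀ p s → s ~ other p s
    ~other p s with p ≟ nbr₁ (deg2 s)
    ... | yes _ = ~nbr₂ (deg2 s)
    ... | no _  = ~nbr₁ (deg2 s)

    other≢ : ∀ p s → other p s ≢ p
    other≢ p s with p ≟ nbr₁ (deg2 s)
    ... | yes refl = λ e → nbr₁≢nbr₂ (deg2 s) (sym e)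
    ... | no p≢n₁  = λ e → p≢n₁ (sym e)

    walk : V H → V H → ℕ → V H
    walk p q zero    = p
    walk p q (suc n) = walk q (other p q) n

    walk-adjacent : ∀ {p q} → p ~ q → ∀ n → walk p q n ~ walk p q (suc n)
    walk-adjacent p~q zero    = p~q
    walk-adjacent {p} {q} p~q (suc n) = walk-adjacent (~other p q) n

    walk-other : ∀ p q n → walk p q (suc (suc n)) ≡ other (walk p q n) (walk p q (suc n))
    walk-other p q zero    = refl
    walk-other p q (suc n) = walk-other q (other p q) n

    walk-no-backtrack : ∀ p q n → walk p q (suc (suc n)) ≢ walk p q n
    walk-no-backtrack p q n e = other≢ (walk p q n) (walk p q (suc n)) (trans (sym (walk-other p q n)) e)

    module Line {a b : V H} (a~b : a ~ b) where

      F : ℤ → V H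
      F (+ n)    = walk a b n
      F -[1+ n ] = walk a (other b a) (suc n)

      F-adjacent : ∀ x → F x ~ F (sucℤ x)
      F-adjacent (+ n)          = walk-adjacent a~b n
      F-adjacent -[1+ zero ]    = ~-sym (~other b a)
      F-adjacent -[1+ suc n ]   = ~-sym (walk-adjacent (~other b a) (suc n))

      F-no-backtrack : ∀ x → F (sucℤ (sucℤ x)) ≢ F x
      F-no-backtrack (+ n)                = walk-no-backtrack a b n
      F-no-backtrack -[1+ zero ]          = λ e → other≢ b a (sym e)
      F-no-backtrack -[1+ suc zero ]      = λ e → walk-no-backtrack a (other b a) 0 (sym e)
      F-no-backtrack -[1+ suc (suc n) ]   = λ e → walk-no-backtrack a (other b a) (suc n) (sym e)

      F-adjacent⁻ : ∀ x → F x ~ F (predℤ x)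
      F-adjacent⁻ x = ~-sym (subst (λ z → F (predℤ x) ~ F z) (suc-pred x) (F-adjacent (predℤ x)))

      F-pred≢suc : ∀ x → F (predℤ x) ≢ F (sucℤ x)
      F-pred≢suc x e = F-no-backtrack (predℤ x) (trans (cong (λ z → F (sucℤ z)) (suc-pred x)) (sym e))

      F-neighbours : ∀ x w → F x ~ w → w ≡ F (predℤ x) ⊎ w ≡ F (sucℤ x)
      F-neighbours x = DegreeTwo-cover (deg2 (F x)) (F-pred≢suc x) (F-adjacent⁻ x) (F-adjacent x)

      reversal-step : ∀ {x y} → F x ≡ F y → F (sucℤ x) ≡ F (predℤ y) →
                      F (sucℤ (sucℤ x)) ≡ F (predℤ (predℤ y))
      reversal-step {x} {y} e e′
        with F-neighbours (predℤ y) _ (subst (_~ F (sucℤ (sucℤ x))) e′ (F-adjacent (sucℤ x)))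
      ... | inj₁ e″ = e″
      ... | inj₂ e″ = ⊥-elim (F-no-backtrack x (trans e″ (trans (cong F (suc-pred y)) (sym e))))

      -- Walking from a common vertex in opposite directions would, where the two walks
      -- meet, either close a loop or backtrack.
      no-reversal : ∀ d x → F x ≡ F (x + + suc d) → F (sucℤ x) ≢ F (predℤ (x + + suc d))
      no-reversal zero x e _ = ~⇒≢ (F-adjacent x) (trans e (cong F (one-step x)))
        where
        one-step : ∀ x → x + 1ℤ ≡ 1ℤ + x
        one-step = solve-∀
      no-reversal (suc zero) x e _ = F-no-backtrack x (sym (trans e (cong F (two-steps x))))
        where
        two-steps : ∀ x → x + (1ℤ + 1ℤ) ≡ 1ℤ + (1ℤ + x)
        two-steps = solve-∀
      no-reversal (suc (suc d)) x e e′ =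
        no-reversal d (sucℤ x) (trans e′ (cong F (closer x (+ d))))
          (trans (reversal-step {x} {x + + suc (suc (suc d))} e e′) (cong (λ z → F (predℤ z)) (closer x (+ d))))
        where
        closer : ∀ x i → -1ℤ + (x + (1ℤ + (1ℤ + (1ℤ + i)))) ≡ (1ℤ + x) + (1ℤ + i)
        closer = solve-∀

      forward-from : ∀ d x → F x ≡ F (x + + d) → F (sucℤ x) ≡ F (sucℤ (x + + d))
      forward-from zero x _ = cong (λ z → F (sucℤ z)) (sym (+-identityʳ x))
      forward-from (suc d) x e
        with F-neighbours (x + + suc d) (F (sucℤ x)) (subst (_~ F (sucℤ x)) e (F-adjacent x))
      ... | inj₁ e′ = ⊥-elim (no-reversal d x e e′)
      ... | inj₂ e′ = e′

      F-forward : ∀ x y → F x ≡ F y → F (sucℤ x) ≡ F (sucℤ y)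
      F-forward x y e with ℤ-offset x y
      ... | inj₁ (d , refl) = forward-from d x e
      ... | inj₂ (d , refl) = sym (forward-from d y (sym e))

      F-backward : ∀ x y → F x ≡ F y → F (predℤ x) ≡ F (predℤ y)
      F-backward x y e =
        DegreeTwo-other (deg2 (F y)) (F-pred≢suc y)
          (λ e′ → F-pred≢suc x (trans e′ (sym (F-forward x y e))))
          (F-adjacent⁻ y) (F-adjacent y) (subst (_~ F (predℤ x)) e (F-adjacent⁻ x))

      F-onto : ∀ s → ∃ λ x → F x ≡ s
      F-onto s = transport (λ s → ∃ λ x → F x ≡ s) extend (connected a s) (+ 0 , refl)
        where
        extend : ∀ {s t} → s ~ t → ∃ (λ x → F x ≡ s) → ∃ (λ x → F x ≡ t)
        extend s~t (x , refl) with F-neighbours x _ s~t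
        ... | inj₁ e = predℤ x , sym e
        ... | inj₂ e = sucℤ x , sym e

      index : V H → ℤ
      index s = proj₁ (F-onto s)

      F-index : ∀ s → F (index s) ≡ s
      F-index s = proj₂ (F-onto s)

      F-suc-adjacent : ∀ {x y} → F x ~ F y → F (sucℤ x) ~ F (sucℤ y)
      F-suc-adjacent {x} {y} e with F-neighbours x (F y) e
      ... | inj₁ e′ = subst (F (sucℤ x) ~_) (trans (sym (cong F (suc-pred x))) (F-forward (predℤ x) y (sym e′)))
                            (~-sym (F-adjacent x))
      ... | inj₂ e′ = subst (F (sucℤ x) ~_) (sym (F-forward y (sucℤ x) e′)) (F-adjacent (sucℤ x))

      F-pred-adjacent : ∀ {x y} → F x ~ F y → F (predℤ x) ~ F (predℤ y)
      F-pred-adjacent {x} {y} e with F-neighbours x (F y) e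
      ... | inj₁ e′ = subst (F (predℤ x) ~_) (sym (F-backward y (predℤ x) e′)) (F-adjacent⁻ (predℤ x))
      ... | inj₂ e′ = subst (F (predℤ x) ~_) (trans (sym (cong F (pred-suc x))) (F-backward (sucℤ x) y (sym e′)))
                            (~-sym (F-adjacent⁻ x))

      index-adjacent : ∀ {s t} → s ~ t → F (index s) ~ F (index t)
      index-adjacent {s} {t} = subst₂ _~_ (sym (F-index s)) (sym (F-index t))

      rotation : Aut H
      rotation = mkAut ρ ρ⁻¹ ρ⁻¹∘ρ ρ∘ρ⁻¹
        (λ {s} {t} e → F-suc-adjacent {index s} {index t} (index-adjacent e))
        (λ {s} {t} e → F-pred-adjacent {index s} {index t} (index-adjacent e))
        where
        ρ ρ⁻¹ : V H → V H
        ρ s   = F (sucℤ (index s))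
        ρ⁻¹ s = F (predℤ (index s))
        ρ⁻¹∘ρ : ∀ s → ρ⁻¹ (ρ s) ≡ s
        ρ⁻¹∘ρ s = trans (F-backward (index (ρ s)) (sucℤ (index s)) (F-index (ρ s))) (trans (cong F (pred-suc (index s))) (F-index s))
        ρ∘ρ⁻¹ : ∀ s → ρ (ρ⁻¹ s) ≡ s
        ρ∘ρ⁻¹ s = trans (F-forward (index (ρ⁻¹ s)) (predℤ (index s)) (F-index (ρ⁻¹ s))) (trans (cong F (suc-pred (index s))) (F-index s))

      rotation-F : ∀ x → σ rotation (F x) ≡ F (sucℤ x)
      rotation-F x = F-forward (index (F x)) x (F-index (F x))

      -- The hypotheses exclude cycles of length 3, 4 and 5.  Marking F 0, F 1 and F 3
      -- breaks all symmetry: F 3 is the only marked vertex without a marked neighbour,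
      -- and F 2 is its only neighbour with a second marked neighbour.
      no-short-cycle⇒two-labels : F (+ 4) ≢ F (+ 1) → F (+ 4) ≢ F (+ 0) → F (+ 4) ≢ F -[1+ 0 ] →
                                  HasDistinguishingLabeling H 2
      no-short-cycle⇒two-labels y4≢y1 y4≢y0 y4≢y₋₁ = label , distinguishes
        where
        y0 y1 y2 y3 y4 : V H
        y0 = F (+ 0)
        y1 = F (+ 1)
        y2 = F (+ 2)
        y3 = F (+ 3)
        y4 = F (+ 4)

        Marked : V H → Set
        Marked s = s ≡ y0 ⊎ s ≡ y1 ⊎ s ≡ y3

        label : V H → Fin 2
        label s = bit ((s ≟ y0) ⊎-dec (s ≟ y1) ⊎-dec (s ≟ y3))

        y3-lonely : ∀ w → w ~ y3 → ¬ Marked w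
        y3-lonely w w~y3 m with F-neighbours (+ 3) w (~-sym w~y3) | m
        ... | inj₁ refl | inj₁ e        = F-no-backtrack (+ 0) e
        ... | inj₁ refl | inj₂ (inj₁ e) = ~⇒≢ (F-adjacent (+ 1)) (sym e)
        ... | inj₁ refl | inj₂ (inj₂ e) = ~⇒≢ (F-adjacent (+ 2)) e
        ... | inj₂ refl | inj₁ e        = y4≢y0 e
        ... | inj₂ refl | inj₂ (inj₁ e) = y4≢y1 e
        ... | inj₂ refl | inj₂ (inj₂ e) = ~⇒≢ (F-adjacent (+ 3)) (sym e)

        distinguishes : ∀ φ → (∀ s → label (σ φ s) ≡ label s) → ∀ s → σ φ s ≡ s
        distinguishes φ keeps = fixes-edge⇒fixes-all φ (F-adjacent (+ 2)) fix-y2 fix-y3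
          where
          marked→ : ∀ s → Marked s → Marked (σ φ s)
          marked→ s = bit-reflects _ _ (sym (keeps s))
          marked← : ∀ s → Marked (σ φ s) → Marked s
          marked← s = bit-reflects _ _ (keeps s)

          σy3-lonely : ∀ m → Marked m → ¬ (σ φ y3 ~ m)
          σy3-lonely m mm e = y3-lonely (σ⁻¹ φ m)
            (~-sym (σ-adjacent⁻ φ (subst (σ φ y3 ~_) (sym (right φ m)) e)))
            (marked← (σ⁻¹ φ m) (subst Marked (sym (right φ m)) mm))

          fix-y3 : σ φ y3 ≡ y3
          fix-y3 with marked→ y3 (inj₂ (inj₂ refl))
          ... | inj₁ e        = ⊥-elim (σy3-lonely y1 (inj₂ (inj₁ refl)) (subst (_~ y1) (sym e) (F-adjacent (+ 0))))
          ... | inj₂ (inj₁ e) = ⊥-elim (σy3-lonely y0 (inj₁ refl) (subst (_~ y0) (sym e) (~-sym (F-adjacent (+ 0)))))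
          ... | inj₂ (inj₂ e) = e

          y4-far-from-σy1 : σ φ y1 ~ y4 → ⊥
          y4-far-from-σy1 e with marked→ y1 (inj₂ (inj₁ refl))
          ... | inj₁ e′ with F-neighbours (+ 0) y4 (subst (_~ y4) e′ e)
          ...   | inj₁ e″ = y4≢y₋₁ e″
          ...   | inj₂ e″ = y4≢y1 e″
          y4-far-from-σy1 e | inj₂ (inj₁ e′) with F-neighbours (+ 1) y4 (subst (_~ y4) e′ e)
          ...   | inj₁ e″ = y4≢y0 e″
          ...   | inj₂ e″ = F-no-backtrack (+ 2) e″
          y4-far-from-σy1 e | inj₂ (inj₂ e′) =
            F-no-backtrack (+ 1) (sym (σ-injective φ (trans e′ (sym fix-y3))))

          fix-y2 : σ φ y2 ≡ y2
          fix-y2 with F-neighbours (+ 3) (σ φ y2) (subst (_~ σ φ y2) fix-y3 (σ-adjacent φ (~-sym (F-adjacent (+ 2)))))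
          ... | inj₁ e = e
          ... | inj₂ e = ⊥-elim (y4-far-from-σy1 (subst (σ φ y1 ~_) e (σ-adjacent φ (F-adjacent (+ 1)))))

-- S is H with every edge subdivided once: the branch vertices of S are the image of
-- ι, and every other vertex of S has exactly the two ends of an edge of H as neighbours.
record IsHalving (H S : Graph) : Set where
  field
    _≟_         : DecidableEquality (V S)
    adj-sym     : ∀ s t → adj S s t ≡ adj S t s
    adj-irrefl  : ∀ s → adj S s s ≡ false
    adjᴴ-sym    : ∀ x y → adj H x y ≡ adj H y x
    adjᴴ-irrefl : ∀ x → adj H x x ≡ false

    branch            : V S → Bool
    branch-alternates : ∀ {s t} → Adjacent S s t → branch t ≡ not (branch s)

    ι          : V H → V S
    ι-injective : ∀ {x y} → ι x ≡ ι y → x ≡ y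
    branch-ι   : ∀ x → branch (ι x) ≡ true
    ι⁻¹        : V S → V H
    ι-ι⁻¹      : ∀ s → branch s ≡ true → ι (ι⁻¹ s) ≡ s

    end₁ end₂     : V S → V H
    ends-adjacent : ∀ s → branch s ≡ false → Adjacent H (end₁ s) (end₂ s)
    ~end₁         : ∀ s → branch s ≡ false → Adjacent S s (ι (end₁ s))
    ~end₂         : ∀ s → branch s ≡ false → Adjacent S s (ι (end₂ s))
    ends-only     : ∀ s → branch s ≡ false → ∀ w → Adjacent S s w → w ≡ ι (end₁ s) ⊎ w ≡ ι (end₂ s)

    edge-subdivided : ∀ {x y} → Adjacent H x y → ∃ λ s → Adjacent S (ι x) s × Adjacent S (ι y) s
    no-square       : ∀ {s t a b} → branch s ≡ false → branch t ≡ false → s ≢ t → a ≢ b →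
                      Adjacent S s a → Adjacent S s b → Adjacent S t a → Adjacent S t b → ⊥

module Halving {H S : Graph} (h : IsHalving H S) where

  open IsHalving h
  open Undirected S adj-sym adj-irrefl public
  open Undirected H adjᴴ-sym adjᴴ-irrefl public using ()
    renaming (_~_ to _~ᴴ_; ~-sym to ~ᴴ-sym; ~⇒≢ to ~ᴴ⇒≢)

  branch-cases : ∀ s → branch s ≡ true ⊎ branch s ≡ false
  branch-cases s with branch s
  ... | true  = inj₁ refl
  ... | false = inj₂ refl

  ι⁻¹-ι : ∀ x → ι⁻¹ (ι x) ≡ x
  ι⁻¹-ι x = ι-injective (ι-ι⁻¹ (ι x) (branch-ι x))

  branch-neighbour : ∀ {s w} → branch s ≡ true → s ~ w → branch w ≡ false
  branch-neighbour b e = trans (branch-alternates e) (cong not b)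

  inner-neighbour : ∀ {s w} → branch s ≡ false → s ~ w → branch w ≡ true
  inner-neighbour b e = trans (branch-alternates e) (cong not b)

  ι-neighbour : ∀ {x s} → ι x ~ s → branch s ≡ false
  ι-neighbour {x} = branch-neighbour (branch-ι x)

  ends≢ : ∀ s → branch s ≡ false → end₁ s ≢ end₂ s
  ends≢ s b = ~ᴴ⇒≢ (ends-adjacent s b)

  ι-end : ∀ {s x} → branch s ≡ false → s ~ ι x → x ≡ end₁ s ⊎ x ≡ end₂ s
  ι-end {s} {x} b e = ⊎-map ι-injective ι-injective (ends-only s b (ι x) e)

  ι-ends : ∀ {s x y} → branch s ≡ false → x ≢ y → s ~ ι x → s ~ ι y →
           (x ≡ end₁ s × y ≡ end₂ s) ⊎ (x ≡ end₂ s × y ≡ end₁ s)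
  ι-ends b x≢y sx sy with ι-end b sx | ι-end b sy
  ... | inj₁ e₁ | inj₁ e₂ = ⊥-elim (x≢y (trans e₁ (sym e₂)))
  ... | inj₁ e₁ | inj₂ e₂ = inj₁ (e₁ , e₂)
  ... | inj₂ e₁ | inj₁ e₂ = inj₂ (e₁ , e₂)
  ... | inj₂ e₁ | inj₂ e₂ = ⊥-elim (x≢y (trans e₁ (sym e₂)))

  common-neighbour⇒adjacent : ∀ {x y s} → ι x ~ s → ι y ~ s → x ≢ y → x ~ᴴ y
  common-neighbour⇒adjacent {s = s} xs ys x≢y with ι-ends (ι-neighbour xs) x≢y (~-sym xs) (~-sym ys)
  ... | inj₁ (refl , refl) = ends-adjacent s (ι-neighbour xs)
  ... | inj₂ (refl , refl) = ~ᴴ-sym (ends-adjacent s (ι-neighbour xs))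

  inner-unique : ∀ {r s a b} → branch r ≡ false → branch s ≡ false → a ≢ b →
                 r ~ a → r ~ b → s ~ a → s ~ b → r ≡ s
  inner-unique {r} {s} br bs a≢b ra rb sa sb with r ≟ s
  ... | yes e = e
  ... | no r≢s = ⊥-elim (no-square br bs r≢s a≢b ra rb sa sb)

  opaque
    private
      mid-if : ∀ x y b → adj H x y ≡ b → V S
      mid-if x y true  e = proj₁ (edge-subdivided e)
      mid-if x y false _ = ι x

    -- The subdivision vertex of the edge xy; junk (ι x) when x and y are not adjacent.
    mid : V H → V H → V S
    mid x y = mid-if x y (adj H x y) refl

    mid-adjacent : ∀ {x y} → x ~ᴴ y → ι x ~ mid x y × ι y ~ mid x y
    mid-adjacent {x} {y} xy = go (adj H x y) refl xy
      where
      go : ∀ b (e : adj H x y ≡ b) → b ≡ true → ι x ~ mid-if x y b e × ι y ~ mid-if x y b e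
      go true e _ = proj₂ (edge-subdivided e)

  mid-inner : ∀ {x y} → x ~ᴴ y → branch (mid x y) ≡ false
  mid-inner xy = ι-neighbour (proj₁ (mid-adjacent xy))

  mid-unique : ∀ {x y s} → x ≢ y → ι x ~ s → ι y ~ s → s ≡ mid x y
  mid-unique x≢y xs ys =
    inner-unique (ι-neighbour xs) (mid-inner xy) (λ e → x≢y (ι-injective e))
      (~-sym xs) (~-sym ys) (~-sym (proj₁ (mid-adjacent xy))) (~-sym (proj₂ (mid-adjacent xy)))
    where
    xy = common-neighbour⇒adjacent xs ys x≢y

  mid-sym : ∀ {x y} → x ~ᴴ y → mid x y ≡ mid y x
  mid-sym xy = mid-unique (~ᴴ⇒≢ (~ᴴ-sym xy)) (proj₂ (mid-adjacent xy)) (proj₁ (mid-adjacent xy))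

  mid-ends : ∀ s → branch s ≡ false → mid (end₁ s) (end₂ s) ≡ s
  mid-ends s b = sym (mid-unique (ends≢ s b) (~-sym (~end₁ s b)) (~-sym (~end₂ s b)))

  module Lift (φ : Aut H) where

    lift : V S → V S
    lift s = if branch s then ι (σ φ (ι⁻¹ s)) else mid (σ φ (end₁ s)) (σ φ (end₂ s))

    lift-branch : ∀ s → branch s ≡ true → lift s ≡ ι (σ φ (ι⁻¹ s))
    lift-branch s b rewrite b = refl

    lift-inner : ∀ s → branch s ≡ false → lift s ≡ mid (σ φ (end₁ s)) (σ φ (end₂ s))
    lift-inner s b rewrite b = refl

    lift-ι : ∀ x → lift (ι x) ≡ ι (σ φ x)
    lift-ι x = trans (lift-branch (ι x) (branch-ι x)) (cong (λ z → ι (σ φ z)) (ι⁻¹-ι x))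

    σ-ends-adjacent : ∀ s → branch s ≡ false → σ φ (end₁ s) ~ᴴ σ φ (end₂ s)
    σ-ends-adjacent s b = σ-adjacent φ (ends-adjacent s b)

    lift-inner-adjacent : ∀ s → branch s ≡ false →
                          ι (σ φ (end₁ s)) ~ lift s × ι (σ φ (end₂ s)) ~ lift s
    lift-inner-adjacent s b rewrite lift-inner s b = mid-adjacent (σ-ends-adjacent s b)

    lift-inner-inner : ∀ s → branch s ≡ false → branch (lift s) ≡ false
    lift-inner-inner s b = ι-neighbour (proj₁ (lift-inner-adjacent s b))

    lift-branch-adjacent : ∀ {s t} → branch s ≡ true → s ~ t → lift s ~ lift t
    lift-branch-adjacent {s} {t} b st rewrite lift-branch s b
      with ι-end (branch-neighbour b st) (subst (t ~_) (sym (ι-ι⁻¹ s b)) (~-sym st))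
    ... | inj₁ e = subst (λ z → ι (σ φ z) ~ lift t) (sym e) (proj₁ (lift-inner-adjacent t (branch-neighbour b st)))
    ... | inj₂ e = subst (λ z → ι (σ φ z) ~ lift t) (sym e) (proj₂ (lift-inner-adjacent t (branch-neighbour b st)))

    lift-adjacent : ∀ {s t} → s ~ t → lift s ~ lift t
    lift-adjacent {s} st with branch-cases s
    ... | inj₁ b = lift-branch-adjacent b st
    ... | inj₂ b = ~-sym (lift-branch-adjacent (inner-neighbour b st) (~-sym st))

  open Lift using (lift; lift-ι)

  lift-inverse : (φ : Aut H) → ∀ s → lift (φ ⁻¹ᴬ) (lift φ s) ≡ s
  lift-inverse φ s with branch-cases s
  ... | inj₁ b = begin
    lift (φ ⁻¹ᴬ) (lift φ s)    ≡⟨ cong (lift (φ ⁻¹ᴬ)) (Lift.lift-branch φ s b) ⟩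
    lift (φ ⁻¹ᴬ) (ι (σ φ _))   ≡⟨ lift-ι (φ ⁻¹ᴬ) _ ⟩
    ι (σ⁻¹ φ (σ φ (ι⁻¹ s)))    ≡⟨ cong ι (left φ _) ⟩
    ι (ι⁻¹ s)                  ≡⟨ ι-ι⁻¹ s b ⟩
    s                          ∎
    where open ≡-Reasoning
  ... | inj₂ b with ι-ends (Lift.lift-inner-inner φ s b) σe₁≢σe₂ (~-sym adj₁) (~-sym adj₂)
    where
    σe₁≢σe₂ : σ φ (end₁ s) ≢ σ φ (end₂ s)
    σe₁≢σe₂ e = ends≢ s b (σ-injective φ e)
    adj₁ = proj₁ (Lift.lift-inner-adjacent φ s b)
    adj₂ = proj₂ (Lift.lift-inner-adjacent φ s b)
  ... | inj₁ (e₁ , e₂) = trans (Lift.lift-inner (φ ⁻¹ᴬ) _ (Lift.lift-inner-inner φ s b))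
                           (trans (cong₂ mid (σ≡⇒σ⁻¹≡ φ e₁) (σ≡⇒σ⁻¹≡ φ e₂)) (mid-ends s b))
  ... | inj₂ (e₁ , e₂) = trans (Lift.lift-inner (φ ⁻¹ᴬ) _ (Lift.lift-inner-inner φ s b))
                           (trans (cong₂ mid (σ≡⇒σ⁻¹≡ φ e₂) (σ≡⇒σ⁻¹≡ φ e₁))
                             (trans (sym (mid-sym (ends-adjacent s b))) (mid-ends s b)))

  liftᴬ : Aut H → Aut S
  liftᴬ φ = mkAut (lift φ) (lift (φ ⁻¹ᴬ)) (lift-inverse φ) (lift-inverse (φ ⁻¹ᴬ))
                  (Lift.lift-adjacent φ) (Lift.lift-adjacent (φ ⁻¹ᴬ))

  -- Each edge of H gets the label of its subdivision vertex.
  distinguishing⇒total : V H → ∀ {d} → HasDistinguishingLabeling S d → HasTotalDistinguishingLabeling H d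
  distinguishing⇒total x₀ {d} (c , c-distinguishes) =
    (λ x → c (ι x)) , edge-label , edge-label-sym , distinguishes
    where
    edge-label : V H → V H → Fin d
    edge-label x y = if adj H x y then c (mid x y) else c (ι x₀)

    edge-label-adjacent : ∀ {x y} → x ~ᴴ y → edge-label x y ≡ c (mid x y)
    edge-label-adjacent {x} {y} xy = cong (λ b → if b then c (mid x y) else c (ι x₀)) xy

    edge-label-sym : ∀ x y → edge-label x y ≡ edge-label y x
    edge-label-sym x y with adj H x y in e | adj H y x in e′
    ... | true  | true  = cong c (mid-sym e)
    ... | false | false = refl
    ... | true  | false with trans (sym e) (trans (adjᴴ-sym x y) e′)
    ...   | ()
    edge-label-sym x y | false | true with trans (sym e) (trans (adjᴴ-sym x y) e′)
    ...   | ()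

    distinguishes : ∀ φ → (∀ x → c (ι (σ φ x)) ≡ c (ι x)) →
                    (∀ x y → x ~ᴴ y → edge-label (σ φ x) (σ φ y) ≡ edge-label x y) →
                    ∀ x → σ φ x ≡ x
    distinguishes φ keepsV keepsE x =
      ι-injective (trans (sym (lift-ι φ x)) (c-distinguishes (liftᴬ φ) keeps (ι x)))
      where
      keeps : ∀ s → c (lift φ s) ≡ c s
      keeps s with branch-cases s
      ... | inj₁ b = trans (cong c (Lift.lift-branch φ s b)) (trans (keepsV (ι⁻¹ s)) (cong c (ι-ι⁻¹ s b)))
      ... | inj₂ b = begin
        c (lift φ s)                                   ≡⟨ cong c (Lift.lift-inner φ s b) ⟩
        c (mid (σ φ (end₁ s)) (σ φ (end₂ s)))          ≡⟨ edge-label-adjacent (Lift.σ-ends-adjacent φ s b) ⟨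
        edge-label (σ φ (end₁ s)) (σ φ (end₂ s))       ≡⟨ keepsE _ _ (ends-adjacent s b) ⟩
        edge-label (end₁ s) (end₂ s)                   ≡⟨ edge-label-adjacent (ends-adjacent s b) ⟩
        c (mid (end₁ s) (end₂ s))                      ≡⟨ cong c (mid-ends s b) ⟩
        c s                                            ∎
        where open ≡-Reasoning

  BranchPreserving : Aut S → Set
  BranchPreserving ψ = ∀ s → branch (σ ψ s) ≡ branch s

  ⁻¹-BranchPreserving : ∀ ψ → BranchPreserving ψ → BranchPreserving (ψ ⁻¹ᴬ)
  ⁻¹-BranchPreserving ψ bp s = trans (sym (bp (σ⁻¹ ψ s))) (cong branch (right ψ s))

  module Restrict (ψ : Aut S) (bp : BranchPreserving ψ) where

    restrict : V H → V H
    restrict x = ι⁻¹ (σ ψ (ι x))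

    ι-restrict : ∀ x → ι (restrict x) ≡ σ ψ (ι x)
    ι-restrict x = ι-ι⁻¹ _ (trans (bp (ι x)) (branch-ι x))

    restrict-adjacent : ∀ {x y} → x ~ᴴ y → restrict x ~ᴴ restrict y
    restrict-adjacent {x} {y} xy =
      common-neighbour⇒adjacent (toward x (proj₁ (mid-adjacent xy))) (toward y (proj₂ (mid-adjacent xy)))
        (λ e → ~ᴴ⇒≢ xy (ι-injective (σ-injective ψ (trans (sym (ι-restrict x)) (trans (cong ι e) (ι-restrict y))))))
      where
      toward : ∀ z → ι z ~ mid x y → ι (restrict z) ~ σ ψ (mid x y)
      toward z e = subst (_~ σ ψ (mid x y)) (sym (ι-restrict z)) (σ-adjacent ψ e)

  restrict-inverse : ∀ ψ χ (bpψ : BranchPreserving ψ) (bpχ : BranchPreserving χ) →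
                     (∀ s → σ ψ (σ χ s) ≡ s) → ∀ x → Restrict.restrict ψ bpψ (Restrict.restrict χ bpχ x) ≡ x
  restrict-inverse ψ χ bpψ bpχ ψχ x =
    trans (cong (λ s → ι⁻¹ (σ ψ s)) (Restrict.ι-restrict χ bpχ x)) (trans (cong ι⁻¹ (ψχ (ι x))) (ι⁻¹-ι x))

  restrictᴬ : (ψ : Aut S) → BranchPreserving ψ → Aut H
  restrictᴬ ψ bp = mkAut (Restrict.restrict ψ bp) (Restrict.restrict (ψ ⁻¹ᴬ) bp⁻¹)
    (restrict-inverse (ψ ⁻¹ᴬ) ψ bp⁻¹ bp (left ψ)) (restrict-inverse ψ (ψ ⁻¹ᴬ) bp bp⁻¹ (right ψ))
    (Restrict.restrict-adjacent ψ bp) (Restrict.restrict-adjacent (ψ ⁻¹ᴬ) bp⁻¹)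
    where
    bp⁻¹ = ⁻¹-BranchPreserving ψ bp

  inner-DegreeTwo : ∀ s → branch s ≡ false → DegreeTwo s
  inner-DegreeTwo s b = record
    { nbr₁ = ι (end₁ s) ; nbr₂ = ι (end₂ s)
    ; nbr₁≢nbr₂ = λ e → ends≢ s b (ι-injective e)
    ; ~nbr₁ = ~end₁ s b ; ~nbr₂ = ~end₂ s b ; only = ends-only s b }

  -- A branch vertex of degree other than two cannot be moved to a subdivision vertex,
  -- and branch/subdivision alternate along edges.
  branch-preserved : ∀ x₀ → ¬ DegreeTwo (ι x₀) → (∀ s t → Path s t) → ∀ ψ → BranchPreserving ψ
  branch-preserved x₀ ¬deg2 connected ψ s = transport Preserved propagate (connected (ι x₀) s) at-x₀
    where
    Preserved : V S → Set
    Preserved s = branch (σ ψ s) ≡ branch s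
    propagate : ∀ {s t} → s ~ t → Preserved s → Preserved t
    propagate st p = trans (branch-alternates (σ-adjacent ψ st)) (trans (cong not p) (sym (branch-alternates st)))
    at-x₀ : Preserved (ι x₀)
    at-x₀ with branch-cases (σ ψ (ι x₀))
    ... | inj₁ b = trans b (sym (branch-ι x₀))
    ... | inj₂ b = ⊥-elim (¬deg2 (DegreeTwo-σ⁻ ψ (inner-DegreeTwo _ b)))

  total⇒distinguishing : (∀ ψ → BranchPreserving ψ) →
                         ∀ {d} → HasTotalDistinguishingLabeling H d → HasDistinguishingLabeling S d
  total⇒distinguishing bp {d} (cV , cE , cE-sym , cH-distinguishes) = c , distinguishes
    where
    c : V S → Fin d
    c s = if branch s then cV (ι⁻¹ s) else cE (end₁ s) (end₂ s)

    c-ι : ∀ x → c (ι x) ≡ cV x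
    c-ι x rewrite branch-ι x = cong cV (ι⁻¹-ι x)

    c-inner : ∀ {m x y} → branch m ≡ false → x ≢ y → m ~ ι x → m ~ ι y → c m ≡ cE x y
    c-inner {m} b x≢y mx my with ι-ends b x≢y mx my
    ... | inj₁ (refl , refl) rewrite b = refl
    ... | inj₂ (refl , refl) rewrite b = cE-sym _ _

    distinguishes : ∀ ψ → (∀ s → c (σ ψ s) ≡ c s) → ∀ s → σ ψ s ≡ s
    distinguishes ψ keeps = fixes
      where
      open Restrict ψ (bp ψ)

      keepsV : ∀ x → cV (restrict x) ≡ cV x
      keepsV x = trans (sym (c-ι (restrict x))) (trans (cong c (ι-restrict x)) (trans (keeps (ι x)) (c-ι x)))

      keepsE : ∀ x y → x ~ᴴ y → cE (restrict x) (restrict y) ≡ cE x y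
      keepsE x y xy = trans (sym (c-inner (trans (bp ψ m) (mid-inner xy)) r≢r σm~x σm~y))
                        (trans (keeps m) (c-inner (mid-inner xy) (~ᴴ⇒≢ xy) (~-sym (proj₁ (mid-adjacent xy)))
                                                                             (~-sym (proj₂ (mid-adjacent xy)))))
        where
        m = mid x y
        r≢r : restrict x ≢ restrict y
        r≢r = ~ᴴ⇒≢ (restrict-adjacent xy)
        σm~x : σ ψ m ~ ι (restrict x)
        σm~x = subst (σ ψ m ~_) (sym (ι-restrict x)) (~-sym (σ-adjacent ψ (proj₁ (mid-adjacent xy))))
        σm~y : σ ψ m ~ ι (restrict y)
        σm~y = subst (σ ψ m ~_) (sym (ι-restrict y)) (~-sym (σ-adjacent ψ (proj₂ (mid-adjacent xy))))

      fixes-ι : ∀ x → σ ψ (ι x) ≡ ι x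
      fixes-ι x = trans (sym (ι-restrict x)) (cong ι (cH-distinguishes (restrictᴬ ψ (bp ψ)) keepsV keepsE x))

      fixes : ∀ s → σ ψ s ≡ s
      fixes s with branch-cases s
      ... | inj₁ b = trans (cong (σ ψ) (sym (ι-ι⁻¹ s b))) (trans (fixes-ι (ι⁻¹ s)) (ι-ι⁻¹ s b))
      ... | inj₂ b = inner-unique (trans (bp ψ s) b) b (λ e → ends≢ s b (ι-injective e))
                       (subst (σ ψ s ~_) (fixes-ι (end₁ s)) (σ-adjacent ψ (~end₁ s b)))
                       (subst (σ ψ s ~_) (fixes-ι (end₂ s)) (σ-adjacent ψ (~end₂ s b)))
                       (~end₁ s b) (~end₂ s b)

  no-4-cycle : ∀ {s t a b} → s ≢ t → a ≢ b → s ~ a → s ~ b → t ~ a → t ~ b → ⊥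
  no-4-cycle s≢t a≢b sa sb ta tb with branch-cases _
  ... | inj₁ bs = no-square (branch-neighbour bs sa) (branch-neighbour bs sb) a≢b s≢t
                    (~-sym sa) (~-sym ta) (~-sym sb) (~-sym tb)
  ... | inj₂ bs = no-square bs (trans (not-injective (trans (sym (branch-alternates ta)) (branch-alternates sa))) bs)
                    s≢t a≢b sa sb ta tb

  parity≢ : ∀ {s t} → branch s ≡ not (branch t) → s ≢ t
  parity≢ e refl = not-¬ refl e

  module Cycle (deg2 : ∀ s → DegreeTwo s) (connected : ∀ s t → Path s t) (x₀ : V H) where

    open import Data.Integer using (+_; -[1+_]) renaming (suc to sucℤ)

    open TwoRegular _≟_ deg2 connected
    open Line (DegreeTwo.~nbr₁ (deg2 (ι x₀)))

    branch-F-suc : ∀ x → branch (F (sucℤ x)) ≡ not (branch (F x))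
    branch-F-suc x = branch-alternates (F-adjacent x)

    branch-F-suc² : ∀ x → branch (F (sucℤ (sucℤ x))) ≡ branch (F x)
    branch-F-suc² x = trans (branch-F-suc (sucℤ x)) (trans (cong not (branch-F-suc x)) (not-involutive _))

    rotation² : Aut S
    rotation² = rotation ∘ᴬ rotation

    rotation²-F : ∀ x → σ rotation² (F x) ≡ F (sucℤ (sucℤ x))
    rotation²-F x = trans (cong (σ rotation) (rotation-F x)) (rotation-F (sucℤ x))

    rotation²-branch : BranchPreserving rotation²
    rotation²-branch s = subst (λ z → branch (σ rotation² z) ≡ branch z) (F-index s)
                           (trans (cong branch (rotation²-F (index s))) (branch-F-suc² (index s)))

    -- The double rotation restricts to a non-trivial automorphism of H.
    no-total-1 : ¬ HasTotalDistinguishingLabeling H 1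
    no-total-1 (cV , cE , _ , cH-distinguishes) =
      F-no-backtrack (+ 0) (trans (sym (rotation²-F (+ 0))) (trans (sym (ι-restrict x₀)) (cong ι fixed)))
      where
      open Restrict rotation² rotation²-branch
      one-label : ∀ (i j : Fin 1) → i ≡ j
      one-label zero zero = refl
      fixed : restrict x₀ ≡ x₀
      fixed = cH-distinguishes (restrictᴬ rotation² rotation²-branch) (λ _ → one-label _ _) (λ _ _ _ → one-label _ _) x₀

    two-labels : HasDistinguishingLabeling S 2
    two-labels = no-short-cycle⇒two-labels y4≢y1 y4≢y0 y4≢y₋₁
      where
      y4≢y1 : F (+ 4) ≢ F (+ 1)
      y4≢y1 = parity≢ (trans (branch-F-suc² (+ 2)) (branch-F-suc (+ 1)))
      y4≢y₋₁ : F (+ 4) ≢ F -[1+ 0 ]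
      y4≢y₋₁ = parity≢ (trans (branch-F-suc² (+ 2)) (trans (branch-F-suc² (+ 0)) (branch-F-suc -[1+ 0 ])))
      y4≢y0 : F (+ 4) ≢ F (+ 0)
      y4≢y0 e = no-4-cycle (λ e′ → F-no-backtrack (+ 1) (sym e′)) (λ e′ → F-no-backtrack (+ 0) (sym e′))
                  (~-sym (F-adjacent (+ 0))) (F-adjacent (+ 1))
                  (subst (F (+ 3) ~_) e (F-adjacent (+ 3))) (~-sym (F-adjacent (+ 2)))

open import Data.Nat using (_+_)
open import Data.Nat.Properties
  using (≡ᵇ⇒≡; ≡⇒≡ᵇ; <ᵇ⇒<; <⇒<ᵇ; suc-injective; <-irrefl; <-asym; <-trans; ≤-refl; ≤-trans; ≤-antisym; ≤-pred;
         +-suc; +-comm; +-identityʳ; +-cancelʳ-≡; +-mono-≤; n<1+n; m≤n+m; m≤n⇒m≤1+n; ≤∧≢⇒<; ≮⇒≥; ≰⇒>;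
         module ≤-Reasoning)
open import Data.Nat.Tactic.RingSolver using (solve-∀)

∧-true⁻ : ∀ {a b} → a ∧ b ≡ true → a ≡ true × b ≡ true
∧-true⁻ {true} {true} _ = refl , refl

∧-true : ∀ {a b} → a ≡ true → b ≡ true → a ∧ b ≡ true
∧-true refl refl = refl

∨-true⁻ : ∀ {a b} → a ∨ b ≡ true → a ≡ true ⊎ b ≡ true
∨-true⁻ {true}  _ = inj₁ refl
∨-true⁻ {false} e = inj₂ e

∨-true₁ : ∀ {a b} → a ≡ true → a ∨ b ≡ true
∨-true₁ refl = refl

∨-true₂ : ∀ {a b} → b ≡ true → a ∨ b ≡ true
∨-true₂ {true}  _ = refl
∨-true₂ {false} e = e

≡ᵇ-true⁻ : ∀ {m n} → (m ≡ᵇ n) ≡ true → m ≡ n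
≡ᵇ-true⁻ {m} {n} e = ≡ᵇ⇒≡ m n (Equivalence.from T-≡ e)

≡ᵇ-true : ∀ {m n} → m ≡ n → (m ≡ᵇ n) ≡ true
≡ᵇ-true {m} {n} e = Equivalence.to T-≡ (≡⇒≡ᵇ m n e)

<ᵇ-true⁻ : ∀ {m n} → (m <ᵇ n) ≡ true → m < n
<ᵇ-true⁻ {m} {n} e = <ᵇ⇒< m n (Equivalence.from T-≡ e)

<ᵇ-true : ∀ {m n} → m < n → (m <ᵇ n) ≡ true
<ᵇ-true lt = Equivalence.to T-≡ (<⇒<ᵇ lt)

≡ᵇ-sym : ∀ m n → (m ≡ᵇ n) ≡ (n ≡ᵇ m)
≡ᵇ-sym zero    zero    = refl
≡ᵇ-sym zero    (suc n) = refl
≡ᵇ-sym (suc m) zero    = refl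
≡ᵇ-sym (suc m) (suc n) = ≡ᵇ-sym m n

≡ᵇ-suc : ∀ n → (suc n ≡ᵇ n) ≡ false
≡ᵇ-suc zero    = refl
≡ᵇ-suc (suc n) = ≡ᵇ-suc n

module _ {n : ℕ} where

  ==ᶠ-true⁻ : ∀ {a b : Fin n} → (a ==ᶠ b) ≡ true → a ≡ b
  ==ᶠ-true⁻ e = toℕ-injective (≡ᵇ-true⁻ e)

  ==ᶠ-true : ∀ {a b : Fin n} → a ≡ b → (a ==ᶠ b) ≡ true
  ==ᶠ-true {a} refl = ≡ᵇ-true {toℕ a} refl

  ==ᶠ-sym : ∀ (a b : Fin n) → (a ==ᶠ b) ≡ (b ==ᶠ a)
  ==ᶠ-sym a b = ≡ᵇ-sym (toℕ a) (toℕ b)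

-- In the path graph on ℕ two distinct vertices have at most one common neighbour.
path-common-neighbour : ∀ {j j′ l l′ : ℕ} → j ≢ j′ →
  (suc j ≡ l ⊎ suc l ≡ j) → (suc j′ ≡ l ⊎ suc l ≡ j′) →
  (suc j ≡ l′ ⊎ suc l′ ≡ j) → (suc j′ ≡ l′ ⊎ suc l′ ≡ j′) → l ≡ l′
path-common-neighbour ne (inj₁ refl) (inj₁ e) _ _ = ⊥-elim (ne (suc-injective (sym e)))
path-common-neighbour ne (inj₂ refl) (inj₂ refl) _ _ = ⊥-elim (ne refl)
path-common-neighbour ne (inj₁ refl) (inj₂ refl) (inj₁ refl) _ = refl
path-common-neighbour ne (inj₁ refl) (inj₂ refl) (inj₂ refl) (inj₁ ())
path-common-neighbour ne (inj₁ refl) (inj₂ refl) (inj₂ refl) (inj₂ ())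
path-common-neighbour ne (inj₂ refl) (inj₁ refl) (inj₁ refl) (inj₁ ())
path-common-neighbour ne (inj₂ refl) (inj₁ refl) (inj₁ refl) (inj₂ ())
path-common-neighbour ne (inj₂ refl) (inj₁ refl) (inj₂ refl) _ = refl

module Subdivision {n : ℕ} (G : SimpleGraph n) where

  open SimpleGraph G renaming (adj to adjᴳ; sym to adjᴳ-sym; irrefl to adjᴳ-irrefl)

  Vertex : ℕ → Set
  Vertex m = V (subdivision m G)

  internal-≡ : ∀ {m} {u v u′ v′ : Fin n} {i i′ : Fin (m ∸ 1)} {e : T (EdgeLt G u v)} {e′ : T (EdgeLt G u′ v′)} →
               u ≡ u′ → v ≡ v′ → toℕ i ≡ toℕ i′ →
               _≡_ {A = Vertex m} (inj₂ ((u , v , i) , e)) (inj₂ ((u′ , v′ , i′) , e′))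
  internal-≡ {e = e} {e′} refl refl ti with toℕ-injective ti
  ... | refl = cong (λ z → inj₂ (_ , z)) (T-irrelevant e e′)

  internal-≡⁻ : ∀ {m} {u v u′ v′ : Fin n} {i i′ : Fin (m ∸ 1)} {e : T (EdgeLt G u v)} {e′ : T (EdgeLt G u′ v′)} →
                _≡_ {A = Vertex m} (inj₂ ((u , v , i) , e)) (inj₂ ((u′ , v′ , i′) , e′)) →
                u ≡ u′ × v ≡ v′ × toℕ i ≡ toℕ i′
  internal-≡⁻ refl = refl , refl , refl

  _≟_ : ∀ {m} → DecidableEquality (Vertex m)
  inj₁ a ≟ inj₁ b with a ≟ᶠ b
  ... | yes refl = yes refl
  ... | no a≢b   = no λ { refl → a≢b refl }
  inj₁ _ ≟ inj₂ _ = no λ ()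
  inj₂ _ ≟ inj₁ _ = no λ ()
  _≟_ {m} (inj₂ ((u , v , i) , _)) (inj₂ ((u′ , v′ , i′) , _)) with u ≟ᶠ u′ | v ≟ᶠ v′ | i ≟ᶠ i′
  ... | yes p | yes q | yes r = yes (internal-≡ {m} p q (cong toℕ r))
  ... | no p  | _     | _     = no λ e → p (proj₁ (internal-≡⁻ {m} e))
  ... | yes _ | no q  | _     = no λ e → q (proj₁ (proj₂ (internal-≡⁻ {m} e)))
  ... | yes _ | yes _ | no r  = no λ e → r (toℕ-injective (proj₂ (proj₂ (internal-≡⁻ {m} e))))

  adj-sym : ∀ m (x y : Vertex m) → adj (subdivision m G) x y ≡ adj (subdivision m G) y x
  adj-sym m (inj₁ a) (inj₁ b) = cong (_∧ (m ≡ᵇ 1)) (adjᴳ-sym a b)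
  adj-sym m (inj₁ a) (inj₂ _) = refl
  adj-sym m (inj₂ _) (inj₁ a) = refl
  adj-sym m (inj₂ ((u , v , i) , _)) (inj₂ ((u′ , v′ , i′) , _)) =
    cong₂ _∧_ (==ᶠ-sym u u′) (cong₂ _∧_ (==ᶠ-sym v v′) (∨-comm (suc (toℕ i) ≡ᵇ toℕ i′) (suc (toℕ i′) ≡ᵇ toℕ i)))

  adj-irrefl : ∀ m (x : Vertex m) → adj (subdivision m G) x x ≡ false
  adj-irrefl m (inj₁ a) rewrite adjᴳ-irrefl a = refl
  adj-irrefl m (inj₂ ((u , v , i) , _))
    rewrite ==ᶠ-true {a = u} refl | ==ᶠ-true {a = v} refl | ≡ᵇ-suc (toℕ i) = refl

  edgeLt⇒adjacent : ∀ {u v} → T (EdgeLt G u v) → adjᴳ u v ≡ true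
  edgeLt⇒adjacent {u} {v} e with adjᴳ u v
  ... | true = refl

  edgeLt⇒< : ∀ {u v} → T (EdgeLt G u v) → toℕ u < toℕ v
  edgeLt⇒< {u} {v} e with adjᴳ u v | toℕ u <ᵇ toℕ v in lt
  ... | true | true = <ᵇ-true⁻ lt

  edgeLt : ∀ {u v} → adjᴳ u v ≡ true → toℕ u < toℕ v → T (EdgeLt G u v)
  edgeLt {u} {v} p q rewrite p | <ᵇ-true q = tt

  edgeLt⇒≢ : ∀ {u v} → T (EdgeLt G u v) → u ≢ v
  edgeLt⇒≢ e refl = <-irrefl refl (edgeLt⇒< e)

  adjacent⇒≢ : ∀ {a b} → adjᴳ a b ≡ true → toℕ b ≢ toℕ a
  adjacent⇒≢ {a} h eq with toℕ-injective eq
  ... | refl with trans (sym h) (adjᴳ-irrefl a)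
  ...   | ()

  edgeLt-oriented : ∀ {a b} → adjᴳ a b ≡ true → ¬ (toℕ a < toℕ b) → T (EdgeLt G b a)
  edgeLt-oriented {a} {b} h a≮b = edgeLt (trans (adjᴳ-sym b a) h) (≤∧≢⇒< (≮⇒≥ a≮b) (adjacent⇒≢ h))

  module Adjacency (m : ℕ) where

    -- Opaque, so that the implicit endpoints of the lemmas below are inferred by unification
    -- instead of being lost when adjacency computes.
    opaque
      infix 4 _~_
      _~_ : Vertex m → Vertex m → Set
      _~_ = Adjacent (subdivision m G)

      ~⇒adjacent : ∀ {x y} → x ~ y → Adjacent (subdivision m G) x y
      ~⇒adjacent e = e

      adjacent⇒~ : ∀ {x y} → Adjacent (subdivision m G) x y → x ~ y
      adjacent⇒~ e = e

      ~-sym : ∀ {x y} → x ~ y → y ~ x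
      ~-sym {x} {y} e = trans (adj-sym m y x) e

      original~original⁻ : ∀ {a b} → inj₁ a ~ inj₁ b → adjᴳ a b ≡ true × m ≡ 1
      original~original⁻ e = map₂ ≡ᵇ-true⁻ (∧-true⁻ e)

      original~original : ∀ {a b} → adjᴳ a b ≡ true → m ≡ 1 → inj₁ a ~ inj₁ b
      original~original h m≡1 = ∧-true h (≡ᵇ-true m≡1)

      internal~original⁻ : ∀ {u v j e a} → inj₂ ((u , v , j) , e) ~ inj₁ a →
                           (a ≡ u × toℕ j ≡ 0) ⊎ (a ≡ v × toℕ j + 2 ≡ m)
      internal~original⁻ e with ∨-true⁻ e
      ... | inj₁ p = inj₁ (==ᶠ-true⁻ (proj₁ (∧-true⁻ p)) , ≡ᵇ-true⁻ (proj₂ (∧-true⁻ p)))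
      ... | inj₂ p = inj₂ (==ᶠ-true⁻ (proj₁ (∧-true⁻ p)) , ≡ᵇ-true⁻ (proj₂ (∧-true⁻ p)))

      internal~tail : ∀ {u v j e} → toℕ j ≡ 0 → inj₂ ((u , v , j) , e) ~ inj₁ u
      internal~tail {u} q = ∨-true₁ (∧-true (==ᶠ-true {a = u} refl) (≡ᵇ-true q))

      internal~head : ∀ {u v j e} → toℕ j + 2 ≡ m → inj₂ ((u , v , j) , e) ~ inj₁ v
      internal~head {u} {v} {j} q = ∨-true₂ {(v ==ᶠ u) ∧ (toℕ j ≡ᵇ 0)} (∧-true (==ᶠ-true {a = v} refl) (≡ᵇ-true q))

      internal~internal⁻ : ∀ {u v j e u′ v′ j′ e′} → inj₂ ((u , v , j) , e) ~ inj₂ ((u′ , v′ , j′) , e′) →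
                           u ≡ u′ × v ≡ v′ × (suc (toℕ j) ≡ toℕ j′ ⊎ suc (toℕ j′) ≡ toℕ j)
      internal~internal⁻ e with ∧-true⁻ e
      ... | p , q with ∧-true⁻ q
      ... | q₁ , q₂ = ==ᶠ-true⁻ p , ==ᶠ-true⁻ q₁ , ⊎-map ≡ᵇ-true⁻ ≡ᵇ-true⁻ (∨-true⁻ q₂)

      internal~next : ∀ {u v j e j′ e′} → suc (toℕ j) ≡ toℕ j′ → inj₂ ((u , v , j) , e) ~ inj₂ ((u , v , j′) , e′)
      internal~next {u} {v} r = ∧-true (==ᶠ-true {a = u} refl) (∧-true (==ᶠ-true {a = v} refl) (∨-true₁ (≡ᵇ-true r)))

      internal~prev : ∀ {u v j e j′ e′} → suc (toℕ j′) ≡ toℕ j → inj₂ ((u , v , j) , e) ~ inj₂ ((u , v , j′) , e′)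
      internal~prev {u} {v} {j} {j′ = j′} r =
        ∧-true (==ᶠ-true {a = u} refl) (∧-true (==ᶠ-true {a = v} refl) (∨-true₂ {suc (toℕ j) ≡ᵇ toℕ j′} (≡ᵇ-true r)))

    last-index : ∀ {l} → l < m ∸ 1 → ¬ (suc l < m ∸ 1) → l + 2 ≡ m
    last-index {l} p q = trans (+-comm l 2) (∸1≡ m (sym (≤-antisym p (≤-pred (≰⇒> q)))))
      where
      ∸1≡ : ∀ m {k} → m ∸ 1 ≡ suc k → suc (suc k) ≡ m
      ∸1≡ (suc m) e = cong suc (sym e)

    last-index⁻ : ∀ {l} → l + 2 ≡ m → ¬ (suc l < m ∸ 1)
    last-index⁻ {l} e r with trans (sym (+-comm l 2)) e
    ... | refl = <-irrefl refl r

    -- The neighbours of the (l+1)-th vertex of the path subdividing the edge uv.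
    lower-at : ∀ {u v} → T (EdgeLt G u v) → (l : ℕ) → l < m ∸ 1 → Vertex m
    lower-at {u} e zero    _ = inj₁ u
    lower-at {u} {v} e (suc l) p = inj₂ ((u , v , fromℕ< (<-trans (n<1+n l) p)) , e)

    upper-at : ∀ {u v} → T (EdgeLt G u v) → (l : ℕ) → Vertex m
    upper-at {u} {v} e l with suc l <? m ∸ 1
    ... | yes q = inj₂ ((u , v , fromℕ< q) , e)
    ... | no _  = inj₁ v

    lower-at≢upper-at : ∀ {u v} (e : T (EdgeLt G u v)) l p → lower-at e l p ≢ upper-at e l
    lower-at≢upper-at e l p with suc l <? m ∸ 1
    lower-at≢upper-at e zero    p | yes r = λ ()
    lower-at≢upper-at e (suc l) p | yes r = λ eq →
      <-irrefl (trans (sym (toℕ-fromℕ< _)) (trans (proj₂ (proj₂ (internal-≡⁻ {m} eq))) (toℕ-fromℕ< r)))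
               (<-trans (n<1+n l) (n<1+n (suc l)))
    lower-at≢upper-at e zero    p | no r  = λ { refl → edgeLt⇒≢ e refl }
    lower-at≢upper-at e (suc l) p | no r  = λ ()

    module _ {u v : Fin n} {e : T (EdgeLt G u v)} {j : Fin (m ∸ 1)} where

      private
        s : Vertex m
        s = inj₂ ((u , v , j) , e)

      ~lower-at : ∀ l p → toℕ j ≡ l → s ~ lower-at e l p
      ~lower-at zero    p q = internal~tail q
      ~lower-at (suc l) p q = internal~prev (trans (cong suc (toℕ-fromℕ< _)) (sym q))

      ~upper-at : ∀ l → l < m ∸ 1 → toℕ j ≡ l → s ~ upper-at e l
      ~upper-at l p q with suc l <? m ∸ 1
      ... | yes r = internal~next (trans (cong suc q) (sym (toℕ-fromℕ< r)))
      ... | no r  = internal~head (trans (cong (_+ 2) q) (last-index p r))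

      neighbours-at : ∀ l p → toℕ j ≡ l → ∀ w → s ~ w → w ≡ lower-at e l p ⊎ w ≡ upper-at e l
      neighbours-at l p q (inj₁ a) sw with internal~original⁻ {u} {v} {j} {e} {a} sw
      neighbours-at zero    p q (inj₁ a) sw | inj₁ (refl , _) = inj₁ refl
      neighbours-at (suc l) p q (inj₁ a) sw | inj₁ (refl , z) with trans (sym q) z
      ... | ()
      neighbours-at l p q (inj₁ a) sw | inj₂ (refl , t) with suc l <? m ∸ 1
      ... | yes r = ⊥-elim (last-index⁻ (trans (cong (_+ 2) (sym q)) t) r)
      ... | no r  = inj₂ refl
      neighbours-at l p q (inj₂ ((u′ , v′ , j′) , e′)) sw with internal~internal⁻ {u} {v} {j} {e} {u′} {v′} {j′} {e′} sw
      ... | refl , refl , inj₁ t with suc l <? m ∸ 1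
      ...   | yes r = inj₂ (internal-≡ {m} refl refl (trans (sym t) (trans (cong suc q) (sym (toℕ-fromℕ< r)))))
      ...   | no r  = ⊥-elim (r (subst (_< m ∸ 1) (trans (sym t) (cong suc q)) (toℕ<n j′)))
      neighbours-at zero p q (inj₂ ((u′ , v′ , j′) , e′)) sw | refl , refl , inj₂ t with trans t q
      ... | ()
      neighbours-at (suc l) p q (inj₂ ((u′ , v′ , j′) , e′)) sw | refl , refl , inj₂ t =
        inj₁ (internal-≡ {m} refl refl (trans (suc-injective (trans t q)) (sym (toℕ-fromℕ< _))))

    lower upper : Vertex m → Vertex m
    lower (inj₁ a) = inj₁ a
    lower (inj₂ ((u , v , j) , e)) = lower-at e (toℕ j) (toℕ<n j)
    upper (inj₁ a) = inj₁ a
    upper (inj₂ ((u , v , j) , e)) = upper-at e (toℕ j)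

    ~lower : ∀ {u v j e} → inj₂ ((u , v , j) , e) ~ lower (inj₂ ((u , v , j) , e))
    ~lower {j = j} = ~lower-at (toℕ j) (toℕ<n j) refl

    ~upper : ∀ {u v j e} → inj₂ ((u , v , j) , e) ~ upper (inj₂ ((u , v , j) , e))
    ~upper {j = j} = ~upper-at (toℕ j) (toℕ<n j) refl

    lower≢upper : ∀ {u v j e} → lower (inj₂ ((u , v , j) , e)) ≢ upper (inj₂ ((u , v , j) , e))
    lower≢upper {j = j} {e} = lower-at≢upper-at e (toℕ j) (toℕ<n j)

    internal-neighbours : ∀ {u v j e} w → inj₂ ((u , v , j) , e) ~ w →
                          w ≡ lower (inj₂ ((u , v , j) , e)) ⊎ w ≡ upper (inj₂ ((u , v , j) , e))
    internal-neighbours {j = j} = neighbours-at (toℕ j) (toℕ<n j) refl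

    two-internal~original : ∀ {u v j e j′ e′ w} → toℕ j ≢ toℕ j′ →
                            inj₂ ((u , v , j) , e) ~ inj₁ w → inj₂ ((u , v , j′) , e′) ~ inj₁ w → ⊥
    two-internal~original {u} {v} {j} {e} {j′} {e′} {w} ne sw tw
      with internal~original⁻ sw | internal~original⁻ tw
    ... | inj₁ (_ , z₁)    | inj₁ (_ , z₂)    = ne (trans z₁ (sym z₂))
    ... | inj₁ (refl , _)  | inj₂ (refl , _)  = edgeLt⇒≢ e refl
    ... | inj₂ (refl , _)  | inj₁ (refl , _)  = edgeLt⇒≢ e refl
    ... | inj₂ (_ , z₁)    | inj₂ (_ , z₂)    = ne (+-cancelʳ-≡ _ _ _ (trans z₁ (sym z₂)))

    internal-no-square : ∀ (s t : Internal G m) {a b} → _≢_ {A = Vertex m} (inj₂ s) (inj₂ t) → a ≢ b →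
                         inj₂ s ~ a → inj₂ s ~ b → inj₂ t ~ a → inj₂ t ~ b → ⊥
    internal-no-square ((u , v , j) , e) ((u′ , v′ , j′) , e′) {inj₂ ((p , q , l) , ea)} {b} s≢t a≢b sa sb ta tb
      with internal~internal⁻ sa | internal~internal⁻ ta
    ... | refl , refl , da | refl , refl , da′ = other-end b sb tb a≢b
      where
      ne : toℕ j ≢ toℕ j′
      ne z = s≢t (internal-≡ {m} refl refl z)
      other-end : ∀ b → inj₂ ((u , v , j) , e) ~ b → inj₂ ((u , v , j′) , e′) ~ b →
                  inj₂ ((u , v , l) , ea) ≢ b → ⊥
      other-end (inj₁ w) sb tb _ = two-internal~original ne sb tb
      other-end (inj₂ ((p′ , q′ , l′) , eb)) sb tb a≢b
        with internal~internal⁻ sb | internal~internal⁻ tb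
      ... | refl , refl , db | refl , refl , db′ =
        a≢b (internal-≡ {m} refl refl (path-common-neighbour ne da da′ db db′))
    internal-no-square ((u , v , j) , e) ((u′ , v′ , j′) , e′) {inj₁ w} {inj₂ ((p , q , l) , eb)} s≢t a≢b sa sb ta tb
      with internal~internal⁻ sb | internal~internal⁻ tb
    ... | refl , refl , _ | refl , refl , _ =
      two-internal~original (λ z → s≢t (internal-≡ {m} refl refl z)) sa ta
    internal-no-square ((u , v , j) , e) ((u′ , v′ , j′) , e′) {inj₁ w} {inj₁ w′} s≢t a≢b sa sb ta tb
      with internal~original⁻ sa | internal~original⁻ sb | internal~original⁻ ta | internal~original⁻ tb
    ... | inj₁ (refl , _) | inj₁ (refl , _) | _ | _ = a≢b refl
    ... | inj₂ (refl , _) | inj₂ (refl , _) | _ | _ = a≢b refl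
    ... | _ | _ | inj₁ (refl , _) | inj₁ (refl , _) = a≢b refl
    ... | _ | _ | inj₂ (refl , _) | inj₂ (refl , _) = a≢b refl
    ... | inj₁ (refl , z) | inj₂ (refl , _) | inj₁ (refl , z′) | inj₂ (refl , _) =
      s≢t (internal-≡ {m} refl refl (trans z (sym z′)))
    ... | inj₂ (refl , _) | inj₁ (refl , z) | inj₂ (refl , _) | inj₁ (refl , z′) =
      s≢t (internal-≡ {m} refl refl (trans z (sym z′)))
    ... | inj₁ (refl , _) | inj₂ (refl , _) | inj₂ (refl , _) | inj₁ (refl , _) = <-asym (edgeLt⇒< e) (edgeLt⇒< e′)
    ... | inj₂ (refl , _) | inj₁ (refl , _) | inj₁ (refl , _) | inj₂ (refl , _) = <-asym (edgeLt⇒< e) (edgeLt⇒< e′)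

  DegreeTwoᴳ : Fin n → Set
  DegreeTwoᴳ v = Σ (Fin n) λ b → Σ (Fin n) λ c → b ≢ c × adjᴳ v b ≡ true × adjᴳ v c ≡ true ×
                 (∀ w → adjᴳ v w ≡ true → w ≡ b ⊎ w ≡ c)

  degreeTwoᴳ? : ∀ v → Dec (DegreeTwoᴳ v)
  degreeTwoᴳ? v =
    any? λ b → any? λ c → ¬? (b ≟ᶠ c) ×-dec (adjᴳ v b ≟ᵇ true) ×-dec (adjᴳ v c ≟ᵇ true) ×-dec
      all? (λ w → (adjᴳ v w ≟ᵇ true) →-dec ((w ≟ᶠ b) ⊎-dec (w ≟ᶠ c)))

  module Proper (m : ℕ) (m>1 : 0 < m ∸ 1) where

    open Adjacency m
    open Undirected (subdivision m G) (adj-sym m) (adj-irrefl m) using (DegreeTwo; Path; path-sym)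

    last-fits : (m ∸ 2 < m ∸ 1) × (m ∸ 2 + 2 ≡ m)
    last-fits = go m m>1
      where
      go : ∀ m → 0 < m ∸ 1 → (m ∸ 2 < m ∸ 1) × (m ∸ 2 + 2 ≡ m)
      go (suc (suc r)) _ = n<1+n r , +-comm r 2

    first last : Fin (m ∸ 1)
    first = fromℕ< m>1
    last  = fromℕ< (proj₁ last-fits)

    internal~head-last : ∀ {u v e} → inj₂ ((u , v , last) , e) ~ inj₁ v
    internal~head-last = internal~head (trans (cong (_+ 2) (toℕ-fromℕ< _)) (proj₂ last-fits))

    no-original-edges : ∀ {a b} → ¬ (inj₁ a ~ inj₁ b)
    no-original-edges e = <-irrefl (sym (cong (_∸ 1) (proj₂ (original~original⁻ e)))) m>1

    next-to : (v b : Fin n) → adjᴳ v b ≡ true → Vertex m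
    next-to v b h with toℕ v <? toℕ b
    ... | yes lt  = inj₂ ((v , b , first) , edgeLt h lt)
    ... | no v≮b  = inj₂ ((b , v , last) , edgeLt-oriented h v≮b)

    far-end : Fin n → Vertex m → Fin n
    far-end v (inj₁ a) = a
    far-end v (inj₂ ((p , q , _) , _)) with p ≟ᶠ v
    ... | yes _ = q
    ... | no _  = p

    far-end-next-to : ∀ v b h → far-end v (next-to v b h) ≡ b
    far-end-next-to v b h with toℕ v <? toℕ b
    ... | yes _ with v ≟ᶠ v
    ...   | yes _  = refl
    ...   | no v≢v = ⊥-elim (v≢v refl)
    far-end-next-to v b h | no _ with b ≟ᶠ v
    ...   | yes b≡v = ⊥-elim (adjacent⇒≢ h (cong toℕ b≡v))
    ...   | no _    = refl

    next-to-injective : ∀ {v b c h h′} → next-to v b h ≡ next-to v c h′ → b ≡ c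
    next-to-injective {v} {b} {c} {h} {h′} e =
      trans (sym (far-end-next-to v b h)) (trans (cong (far-end v) e) (far-end-next-to v c h′))

    ~next-to : ∀ v b h → inj₁ v ~ next-to v b h
    ~next-to v b h with toℕ v <? toℕ b
    ... | yes lt = ~-sym (internal~tail (toℕ-fromℕ< m>1))
    ... | no _   = ~-sym internal~head-last

    next-to-only : ∀ v w → inj₁ v ~ w → ∃ λ b → Σ (adjᴳ v b ≡ true) λ h → w ≡ next-to v b h
    next-to-only v (inj₁ a) vw = ⊥-elim (no-original-edges vw)
    next-to-only v (inj₂ ((p , q , j) , e)) vw
      with internal~original⁻ (~-sym vw)
    ... | inj₁ (refl , z) = q , edgeLt⇒adjacent e , lemma
      where
      lemma : inj₂ ((v , q , j) , e) ≡ next-to v q (edgeLt⇒adjacent e)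
      lemma with toℕ v <? toℕ q
      ... | yes _   = internal-≡ {m} refl refl (trans z (sym (toℕ-fromℕ< m>1)))
      ... | no v≮q  = ⊥-elim (v≮q (edgeLt⇒< e))
    ... | inj₂ (refl , t) = p , trans (adjᴳ-sym v p) (edgeLt⇒adjacent e) , lemma
      where
      lemma : inj₂ ((p , v , j) , e) ≡ next-to v p (trans (adjᴳ-sym v p) (edgeLt⇒adjacent e))
      lemma with toℕ v <? toℕ p
      ... | yes v<p = ⊥-elim (<-asym v<p (edgeLt⇒< e))
      ... | no _    = internal-≡ {m} refl refl
                        (+-cancelʳ-≡ _ _ _ (trans t (sym (trans (cong (_+ 2) (toℕ-fromℕ< _)) (proj₂ last-fits)))))

    next-to-irrelevant : ∀ {v b} (h h′ : adjᴳ v b ≡ true) → next-to v b h ≡ next-to v b h′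
    next-to-irrelevant {v} {b} h h′ = cong (next-to v b) (Decidable⇒UIP.≡-irrelevant _≟ᵇ_ h h′)

    internal-DegreeTwo : ∀ s → DegreeTwo (inj₂ s)
    internal-DegreeTwo ((u , v , j) , e) = record
      { nbr₁ = lower (inj₂ ((u , v , j) , e)) ; nbr₂ = upper (inj₂ ((u , v , j) , e))
      ; nbr₁≢nbr₂ = lower≢upper
      ; ~nbr₁ = ~⇒adjacent (~lower {u} {v} {j} {e}) ; ~nbr₂ = ~⇒adjacent (~upper {u} {v} {j} {e})
      ; only = λ w sw → internal-neighbours w (adjacent⇒~ sw) }

    DegreeTwoᴳ⇒DegreeTwo : ∀ v → DegreeTwoᴳ v → DegreeTwo (inj₁ v)
    DegreeTwoᴳ⇒DegreeTwo v (b , c , b≢c , hb , hc , only) = record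
      { nbr₁ = next-to v b hb ; nbr₂ = next-to v c hc
      ; nbr₁≢nbr₂ = λ e → b≢c (next-to-injective e)
      ; ~nbr₁ = ~⇒adjacent (~next-to v b hb) ; ~nbr₂ = ~⇒adjacent (~next-to v c hc)
      ; only = λ w vw → cover w (adjacent⇒~ vw) }
      where
      cover : ∀ w → inj₁ v ~ w → w ≡ next-to v b hb ⊎ w ≡ next-to v c hc
      cover w vw with next-to-only v w vw
      ... | d , hd , refl with only d hd
      ...   | inj₁ refl = inj₁ (next-to-irrelevant hd hb)
      ...   | inj₂ refl = inj₂ (next-to-irrelevant hd hc)

    DegreeTwo⇒DegreeTwoᴳ : ∀ v → DegreeTwo (inj₁ v) → DegreeTwoᴳ v
    DegreeTwo⇒DegreeTwoᴳ v d
      with next-to-only v _ (adjacent⇒~ (DegreeTwo.~nbr₁ d)) | next-to-only v _ (adjacent⇒~ (DegreeTwo.~nbr₂ d))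
    ... | b , hb , e₁ | c , hc , e₂ =
      b , c , (λ { refl → DegreeTwo.nbr₁≢nbr₂ d (trans e₁ (trans (next-to-irrelevant hb hc) (sym e₂))) }) ,
      hb , hc , cover
      where
      cover : ∀ w → adjᴳ v w ≡ true → w ≡ b ⊎ w ≡ c
      cover w hw with DegreeTwo.only d (next-to v w hw) (~⇒adjacent (~next-to v w hw))
      ... | inj₁ e = inj₁ (next-to-injective (trans e e₁))
      ... | inj₂ e = inj₂ (next-to-injective (trans e e₂))

    edge : ∀ {x y} → x ~ y → Path x y
    edge e = ~⇒adjacent e ◅ ε

    internal-path-to-tail : ∀ l {u v e} (j : Fin (m ∸ 1)) → toℕ j ≡ l → Path (inj₂ ((u , v , j) , e)) (inj₁ u)
    internal-path-to-tail zero    j q = edge (internal~tail q)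
    internal-path-to-tail (suc l) {e = e} j q =
      edge (internal~prev (trans (cong suc (toℕ-fromℕ< l<)) (sym q))) ◅◅ internal-path-to-tail l {e = e} (fromℕ< l<) (toℕ-fromℕ< l<)
      where
      l< : l < m ∸ 1
      l< = <-trans (n<1+n l) (subst (_< m ∸ 1) q (toℕ<n j))

    edgeLt-path : ∀ {u v} (e : T (EdgeLt G u v)) → Path (inj₁ u) (inj₁ v)
    edgeLt-path e = path-sym (internal-path-to-tail _ {e = e} last refl) ◅◅ edge internal~head-last

    edge-path : ∀ {a b} → adjᴳ a b ≡ true → Path (inj₁ a) (inj₁ b)
    edge-path {a} {b} h with toℕ a <? toℕ b
    ... | yes a<b = edgeLt-path (edgeLt h a<b)
    ... | no a≮b  = path-sym (edgeLt-path (edgeLt-oriented h a≮b))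

    reachable⇒path : ∀ {a b} → Reachable G a b → Path (inj₁ a) (inj₁ b)
    reachable⇒path here       = ε
    reachable⇒path (step h r) = edge-path h ◅◅ reachable⇒path r

    origin : Vertex m → Fin n
    origin (inj₁ a)                = a
    origin (inj₂ ((u , _ , _) , _)) = u

    path-to-origin : ∀ s → Path s (inj₁ (origin s))
    path-to-origin (inj₁ a)                = ε
    path-to-origin (inj₂ ((u , v , j) , e)) = internal-path-to-tail (toℕ j) j refl

    connected : Connected G → ∀ s t → Path s t
    connected cG s t = path-to-origin s ◅◅ reachable⇒path (cG _ _) ◅◅ path-sym (path-to-origin t)

odd : ℕ → Bool
odd zero    = false
odd (suc n) = not (odd n)

odd-double : ∀ a → odd (a + a) ≡ false
odd-double zero    = refl
odd-double (suc a) rewrite +-suc a a = trans (not-involutive (odd (a + a))) (odd-double a)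

odd-+2 : ∀ j → odd (j + 2) ≡ odd j
odd-+2 j rewrite +-comm j 2 = not-involutive (odd j)

double-suc : ∀ a → suc a + suc a ≡ suc (suc (a + a))
double-suc a = cong suc (+-suc a a)

double-injective : ∀ a b → a + a ≡ b + b → a ≡ b
double-injective zero    zero    e = refl
double-injective (suc a) (suc b) e =
  cong suc (double-injective a b (suc-injective (suc-injective (trans (sym (double-suc a)) (trans e (double-suc b))))))

parity-split : ∀ j → (odd j ≡ false × j ≡ ⌊ j /2⌋ + ⌊ j /2⌋) ⊎ (odd j ≡ true × j ≡ suc (⌊ j /2⌋ + ⌊ j /2⌋))
parity-split zero          = inj₁ (refl , refl)
parity-split (suc zero)    = inj₂ (refl , refl)
parity-split (suc (suc j)) with parity-split j
... | inj₁ (o , e) = inj₁ (trans (not-involutive (odd j)) o , trans (cong (λ z → suc (suc z)) e) (sym (double-suc ⌊ j /2⌋)))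
... | inj₂ (o , e) = inj₂ (trans (not-involutive (odd j)) o ,
                           trans (cong (λ z → suc (suc z)) e) (cong suc (sym (double-suc ⌊ j /2⌋))))

odd⇒ : ∀ j → odd j ≡ true → j ≡ suc (⌊ j /2⌋ + ⌊ j /2⌋)
odd⇒ j o with parity-split j
... | inj₂ (_ , e) = e
... | inj₁ (o′ , _) with trans (sym o) o′
...   | ()

even⇒ : ∀ j → odd j ≡ false → j ≡ ⌊ j /2⌋ + ⌊ j /2⌋
even⇒ j o with parity-split j
... | inj₁ (_ , e) = e
... | inj₂ (o′ , _) with trans (sym o′) o
...   | ()

-- The i-th internal vertex of an edge of G^{1/k} is the (2i+1)-th one in G^{1/2k}.
double-index-fits : ∀ i k → i < k ∸ 1 → suc (i + i) < 2 * k ∸ 1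
double-index-fits i (suc k) lt = begin
  suc (suc (i + i))  ≡⟨ double-suc i ⟨
  suc i + suc i      ≤⟨ +-mono-≤ lt (m≤n⇒m≤1+n lt) ⟩
  k + suc k          ≡⟨ cong (λ z → k + suc z) (+-identityʳ k) ⟨
  k + suc (k + 0)    ∎
  where open ≤-Reasoning

half-index-fits : ∀ h k → suc (h + h) < 2 * k ∸ 1 → h < k ∸ 1
half-index-fits h (suc k) lt with h <? k
... | yes h<k = h<k
... | no h≮k  = ⊥-elim (<-irrefl refl (≤-trans lt (begin
  k + suc (k + 0)   ≡⟨ cong (λ z → k + suc z) (+-identityʳ k) ⟩
  k + suc k         ≤⟨ +-mono-≤ (≮⇒≥ h≮k) (s≤s (≮⇒≥ h≮k)) ⟩
  h + suc h         ≡⟨ +-suc h h ⟩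
  suc (h + h)       ∎)))
  where open ≤-Reasoning

module Halving-of-subdivision {n : ℕ} (G : SimpleGraph n) (k : ℕ) where

  open Subdivision G
  open SimpleGraph G renaming (adj to adjᴳ; sym to adjᴳ-sym)

  M : ℕ
  M = 2 * k

  module S = Adjacency M
  module H = Adjacency k
  open S using (_~_)

  M≡k+k : M ≡ k + k
  M≡k+k = cong (k +_) (+-identityʳ k)

  odd-M : odd M ≡ false
  odd-M = trans (cong odd M≡k+k) (odd-double k)

  odd-last : ∀ {j} → j + 2 ≡ M → odd j ≡ false
  odd-last {j} e = trans (sym (odd-+2 j)) (trans (cong odd e) odd-M)

  branch : Vertex M → Bool
  branch (inj₁ _)                = true
  branch (inj₂ ((_ , _ , j) , _)) = odd (toℕ j)

  branch-alternates : ∀ {s t} → s ~ t → branch t ≡ not (branch s)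
  branch-alternates {inj₁ a} {inj₁ b} st with trans (sym odd-M) (cong odd (proj₂ (S.original~original⁻ st)))
  ... | ()
  branch-alternates {inj₁ a} {inj₂ _} st with S.internal~original⁻ (S.~-sym st)
  ... | inj₁ (_ , z) = cong odd z
  ... | inj₂ (_ , z) = odd-last z
  branch-alternates {inj₂ _} {inj₁ a} st with S.internal~original⁻ st
  ... | inj₁ (_ , z) = sym (cong not (cong odd z))
  ... | inj₂ (_ , z) = sym (cong not (odd-last z))
  branch-alternates {inj₂ _} {inj₂ ((_ , _ , j′) , _)} st with S.internal~internal⁻ st
  ... | _ , _ , inj₁ z = cong odd (sym z)
  ... | _ , _ , inj₂ z = trans (sym (not-involutive (odd (toℕ j′)))) (cong not (cong odd z))

  ι-fits : ∀ (i : Fin (k ∸ 1)) → suc (toℕ i + toℕ i) < M ∸ 1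
  ι-fits i = double-index-fits (toℕ i) k (toℕ<n i)

  ι : Vertex k → Vertex M
  ι (inj₁ a)                = inj₁ a
  ι (inj₂ ((u , v , i) , e)) = inj₂ ((u , v , fromℕ< (ι-fits i)) , e)

  ι-index : ∀ (i : Fin (k ∸ 1)) → toℕ (fromℕ< (ι-fits i)) ≡ suc (toℕ i + toℕ i)
  ι-index i = toℕ-fromℕ< (ι-fits i)

  branch-ι : ∀ x → branch (ι x) ≡ true
  branch-ι (inj₁ _)                = refl
  branch-ι (inj₂ ((u , v , i) , e)) = trans (cong odd (ι-index i)) (cong not (odd-double (toℕ i)))

  ι-injective : ∀ {x y} → ι x ≡ ι y → x ≡ y
  ι-injective {inj₁ a} {inj₁ .a} refl = refl
  ι-injective {inj₂ ((u , v , i) , e)} {inj₂ ((u′ , v′ , i′) , e′)} eq with internal-≡⁻ {M} eq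
  ... | refl , refl , z = internal-≡ {k} refl refl
    (double-injective _ _ (suc-injective (trans (sym (ι-index i)) (trans z (ι-index i′)))))

  ι⁻¹ : Vertex M → Vertex k
  ι⁻¹ (inj₁ a) = inj₁ a
  ι⁻¹ (inj₂ ((u , v , j) , e)) with ⌊ toℕ j /2⌋ <? k ∸ 1
  ... | yes p = inj₂ ((u , v , fromℕ< p) , e)
  ... | no _  = inj₁ u

  ι-ι⁻¹ : ∀ s → branch s ≡ true → ι (ι⁻¹ s) ≡ s
  ι-ι⁻¹ (inj₁ a) _ = refl
  ι-ι⁻¹ (inj₂ ((u , v , j) , e)) b with ⌊ toℕ j /2⌋ <? k ∸ 1
  ... | yes p = internal-≡ {M} refl refl
                  (trans (ι-index (fromℕ< p)) (trans (cong (λ z → suc (z + z)) (toℕ-fromℕ< p)) (sym (odd⇒ (toℕ j) b))))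
  ... | no p  = ⊥-elim (p (half-index-fits _ k (subst (_< M ∸ 1) (odd⇒ (toℕ j) b) (toℕ<n j))))

  record CommonNeighbour (x y : Vertex k) : Set where
    constructor common
    field
      vertex : Vertex M
      ι₁~    : ι x ~ vertex
      ι₂~    : ι y ~ vertex

  tail-common-neighbour : ∀ {u v i e} → toℕ i ≡ 0 → CommonNeighbour (inj₁ u) (inj₂ ((u , v , i) , e))
  tail-common-neighbour {u} {v} {i} {e} z =
    common (inj₂ ((u , v , fromℕ< p) , e))
    (S.~-sym (S.internal~tail (toℕ-fromℕ< p)))
    (S.internal~prev (trans (cong suc (toℕ-fromℕ< p)) (sym (trans (ι-index i) (cong (λ w → suc (w + w)) z)))))
    where
    p : 0 < M ∸ 1
    p = <-trans (s≤s z≤n) (ι-fits i)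

  head-common-neighbour : ∀ {u v i e} → toℕ i + 2 ≡ k → CommonNeighbour (inj₁ v) (inj₂ ((u , v , i) , e))
  head-common-neighbour {u} {v} {i} {e} z =
    common (inj₂ ((u , v , fromℕ< p) , e))
      (S.~-sym (S.internal~head (trans (cong (_+ 2) (toℕ-fromℕ< p)) at-end)))
      (S.internal~next (trans (cong suc (ι-index i)) (sym (toℕ-fromℕ< p))))
    where
    at-end : suc (suc (toℕ i + toℕ i)) + 2 ≡ M
    at-end = trans (double+2 (toℕ i)) (trans (cong₂ _+_ z z) (sym M≡k+k))
      where
      double+2 : ∀ a → suc (suc (a + a)) + 2 ≡ (a + 2) + (a + 2)
      double+2 = solve-∀
    p : suc (suc (toℕ i + toℕ i)) < M ∸ 1
    p = subst (λ m′ → suc (suc (toℕ i + toℕ i)) < m′ ∸ 1) (trans (+-comm 2 _) at-end) (n<1+n _)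

  internal-common-neighbour : ∀ {u v i e i′ e′} → suc (toℕ i) ≡ toℕ i′ →
                              CommonNeighbour (inj₂ ((u , v , i) , e)) (inj₂ ((u , v , i′) , e′))
  internal-common-neighbour {u} {v} {i} {e} {i′} {e′} z =
    common (inj₂ ((u , v , fromℕ< p) , e))
      (S.internal~next (trans (cong suc (ι-index i)) (sym (toℕ-fromℕ< p))))
      (S.internal~prev (trans (cong suc (toℕ-fromℕ< p)) (sym (trans (ι-index i′) q))))
    where
    q : suc (toℕ i′ + toℕ i′) ≡ suc (suc (suc (toℕ i + toℕ i)))
    q = trans (cong (λ w → suc (w + w)) (sym z)) (cong suc (double-suc (toℕ i)))
    p : suc (suc (toℕ i + toℕ i)) < M ∸ 1
    p = <-trans (subst (suc (suc (toℕ i + toℕ i)) <_) (sym q) ≤-refl) (ι-fits i′)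

  original-common-neighbour : ∀ {a b} → adjᴳ a b ≡ true → k ≡ 1 → CommonNeighbour (inj₁ a) (inj₁ b)
  original-common-neighbour {a} {b} h refl with toℕ a <? toℕ b
  ... | yes a<b = common (inj₂ ((a , b , fromℕ< (s≤s z≤n)) , edgeLt h a<b))
                    (S.~-sym (S.internal~tail refl)) (S.~-sym (S.internal~head refl))
  ... | no a≮b  = common (inj₂ ((b , a , fromℕ< (s≤s z≤n)) , edgeLt-oriented h a≮b))
                    (S.~-sym (S.internal~head refl)) (S.~-sym (S.internal~tail refl))

  common-neighbour-sym : ∀ {x y} → CommonNeighbour x y → CommonNeighbour y x
  common-neighbour-sym (common s p q) = common s q p

  edge-subdivided : ∀ {x y} → x H.~ y → CommonNeighbour x y
  edge-subdivided {inj₁ a} {inj₁ b} xy = original-common-neighbour (proj₁ (H.original~original⁻ xy)) (proj₂ (H.original~original⁻ xy))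
  edge-subdivided {inj₁ a} {inj₂ ((u , v , i) , e)} xy with H.internal~original⁻ (H.~-sym xy)
  ... | inj₁ (refl , z) = tail-common-neighbour {i = i} z
  ... | inj₂ (refl , z) = head-common-neighbour {i = i} z
  edge-subdivided {inj₂ ((u , v , i) , e)} {inj₁ a} xy with H.internal~original⁻ xy
  ... | inj₁ (refl , z) = common-neighbour-sym (tail-common-neighbour {i = i} z)
  ... | inj₂ (refl , z) = common-neighbour-sym (head-common-neighbour {i = i} z)
  edge-subdivided {inj₂ ((u , v , i) , e)} {inj₂ ((u′ , v′ , i′) , e′)} xy with H.internal~internal⁻ xy
  ... | refl , refl , inj₁ z = internal-common-neighbour {i = i} {i′ = i′} z
  ... | refl , refl , inj₂ z = common-neighbour-sym (internal-common-neighbour {i = i′} {i′ = i} z)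

  module _ {u v : Fin n} {j : Fin (M ∸ 1)} {e : T (EdgeLt G u v)} where

    private
      s : Vertex M
      s = inj₂ ((u , v , j) , e)

    ~ι-internal⁻ : ∀ {p q i e′} → s ~ ι (inj₂ ((p , q , i) , e′)) →
                   u ≡ p × v ≡ q × (toℕ j ≡ toℕ i + toℕ i ⊎ toℕ j ≡ suc (suc (toℕ i + toℕ i)))
    ~ι-internal⁻ {i = i} sx with S.internal~internal⁻ sx
    ... | p , q , inj₁ z = p , q , inj₁ (suc-injective (trans z (ι-index i)))
    ... | p , q , inj₂ z = p , q , inj₂ (trans (sym z) (cong suc (ι-index i)))

    private
      k≡1 : 0 + 2 ≡ M → k ≡ 1
      k≡1 z = sym (double-injective 1 k (trans z M≡k+k))

      beyond-last : ∀ {i : Fin (k ∸ 1)} → (toℕ i + toℕ i) + 2 ≡ M → ⊥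
      beyond-last {i} z = <-irrefl refl (subst (λ k′ → toℕ i < k′ ∸ 1) (sym sk) (toℕ<n i))
        where
        sk : suc (toℕ i) ≡ k
        sk = double-injective (suc (toℕ i)) k (trans (double-suc (toℕ i)) (trans (+-comm 2 _) (trans z M≡k+k)))

      at-last : ∀ {i : Fin (k ∸ 1)} → suc (suc (toℕ i + toℕ i)) + 2 ≡ M → toℕ i + 2 ≡ k
      at-last {i} z = double-injective (toℕ i + 2) k (trans (double+2 (toℕ i)) (trans z M≡k+k))
        where
        double+2 : ∀ a → (a + 2) + (a + 2) ≡ suc (suc (a + a)) + 2
        double+2 = solve-∀

    original~internal : ∀ a p q i e′ → s ~ inj₁ a → s ~ ι (inj₂ ((p , q , i) , e′)) →
                        inj₁ a H.~ inj₂ ((p , q , i) , e′)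
    original~internal a p q i e′ sa sx with S.internal~original⁻ sa | ~ι-internal⁻ {i = i} sx
    ... | inj₁ (refl , z) | refl , refl , inj₁ w =
      H.~-sym (H.internal~tail (double-injective _ 0 (trans (sym w) z)))
    ... | inj₁ (refl , z) | refl , refl , inj₂ w with trans (sym z) w
    ...   | ()
    original~internal a p q i e′ sa sx | inj₂ (refl , z) | refl , refl , inj₁ w =
      ⊥-elim (beyond-last {i} (trans (cong (_+ 2) (sym w)) z))
    original~internal a p q i e′ sa sx | inj₂ (refl , z) | refl , refl , inj₂ w =
      H.~-sym (H.internal~head (at-last {i} (trans (cong (_+ 2) (sym w)) z)))

    branch-neighbours-adjacent : ∀ x y → s ~ ι x → s ~ ι y → x ≢ y → x H.~ y
    branch-neighbours-adjacent (inj₁ a) (inj₁ b) sx sy x≢y with S.internal~original⁻ sx | S.internal~original⁻ sy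
    ... | inj₁ (refl , _) | inj₁ (refl , _) = ⊥-elim (x≢y refl)
    ... | inj₂ (refl , _) | inj₂ (refl , _) = ⊥-elim (x≢y refl)
    ... | inj₁ (refl , z) | inj₂ (refl , w) =
      H.original~original (edgeLt⇒adjacent e) (k≡1 (trans (cong (_+ 2) (sym z)) w))
    ... | inj₂ (refl , w) | inj₁ (refl , z) =
      H.original~original (trans (adjᴳ-sym _ _) (edgeLt⇒adjacent e)) (k≡1 (trans (cong (_+ 2) (sym z)) w))
    branch-neighbours-adjacent (inj₁ a) (inj₂ ((p , q , i) , e′)) sx sy x≢y = original~internal a p q i e′ sx sy
    branch-neighbours-adjacent (inj₂ ((p , q , i) , e′)) (inj₁ a) sx sy x≢y = H.~-sym (original~internal a p q i e′ sy sx)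
    branch-neighbours-adjacent (inj₂ ((p , q , i) , e′)) (inj₂ ((p′ , q′ , i′) , e″)) sx sy x≢y
      with ~ι-internal⁻ {i = i} sx | ~ι-internal⁻ {i = i′} sy
    ... | refl , refl , inj₁ w | refl , refl , inj₁ w′ =
      ⊥-elim (x≢y (internal-≡ {k} refl refl (double-injective _ _ (trans (sym w) w′))))
    ... | refl , refl , inj₂ w | refl , refl , inj₂ w′ =
      ⊥-elim (x≢y (internal-≡ {k} refl refl (double-injective _ _ (suc-injective (suc-injective (trans (sym w) w′))))))
    ... | refl , refl , inj₁ w | refl , refl , inj₂ w′ = H.internal~prev (sym (double-injective _ _ (trans (sym w) (trans w′ (sym (double-suc _))))))
    ... | refl , refl , inj₂ w | refl , refl , inj₁ w′ = H.internal~next (sym (double-injective _ _ (trans (sym w′) (trans w (sym (double-suc _))))))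

  lower-branch : ∀ s → branch s ≡ false → branch (S.lower s) ≡ true
  lower-branch (inj₂ ((u , v , j) , e)) b = trans (branch-alternates (S.~lower {u} {v} {j} {e})) (cong not b)

  upper-branch : ∀ s → branch s ≡ false → branch (S.upper s) ≡ true
  upper-branch (inj₂ ((u , v , j) , e)) b = trans (branch-alternates (S.~upper {u} {v} {j} {e})) (cong not b)

  end₁ end₂ : Vertex M → Vertex k
  end₁ s = ι⁻¹ (S.lower s)
  end₂ s = ι⁻¹ (S.upper s)

  ~ι-end₁ : ∀ s → branch s ≡ false → s ~ ι (end₁ s)
  ~ι-end₁ s@(inj₂ _) b = subst (_ ~_) (sym (ι-ι⁻¹ _ (lower-branch s b))) S.~lower

  ~ι-end₂ : ∀ s → branch s ≡ false → s ~ ι (end₂ s)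
  ~ι-end₂ s@(inj₂ _) b = subst (_ ~_) (sym (ι-ι⁻¹ _ (upper-branch s b))) S.~upper

  ends-adjacent : ∀ s → branch s ≡ false → end₁ s H.~ end₂ s
  ends-adjacent s@(inj₂ _) b = branch-neighbours-adjacent _ _ (~ι-end₁ s b) (~ι-end₂ s b)
    (λ e → S.lower≢upper (trans (sym (ι-ι⁻¹ _ (lower-branch s b))) (trans (cong ι e) (ι-ι⁻¹ _ (upper-branch s b)))))

  ends-only : ∀ s → branch s ≡ false → ∀ w → s ~ w → w ≡ ι (end₁ s) ⊎ w ≡ ι (end₂ s)
  ends-only s@(inj₂ _) b w sw with S.internal-neighbours w sw
  ... | inj₁ refl = inj₁ (sym (ι-ι⁻¹ _ (lower-branch s b)))
  ... | inj₂ refl = inj₂ (sym (ι-ι⁻¹ _ (upper-branch s b)))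

  no-square : ∀ {s t a b} → branch s ≡ false → branch t ≡ false → s ≢ t → a ≢ b →
              s ~ a → s ~ b → t ~ a → t ~ b → ⊥
  no-square {inj₂ s} {inj₂ t} _ _ = S.internal-no-square s t

  halving : IsHalving (subdivision k G) (subdivision M G)
  halving = record
    { _≟_               = _≟_ {M}
    ; adj-sym           = adj-sym M
    ; adj-irrefl        = adj-irrefl M
    ; adjᴴ-sym          = adj-sym k
    ; adjᴴ-irrefl       = adj-irrefl k
    ; branch            = branch
    ; branch-alternates = λ {s} {t} e → branch-alternates {s} {t} (S.adjacent⇒~ e)
    ; ι                 = ι
    ; ι-injective       = ι-injective
    ; branch-ι          = branch-ι
    ; ι⁻¹               = ι⁻¹
    ; ι-ι⁻¹             = ι-ι⁻¹
    ; end₁              = end₁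
    ; end₂              = end₂
    ; ends-adjacent     = λ s b → H.~⇒adjacent (ends-adjacent s b)
    ; ~end₁             = λ s b → S.~⇒adjacent (~ι-end₁ s b)
    ; ~end₂             = λ s b → S.~⇒adjacent (~ι-end₂ s b)
    ; ends-only         = λ s b w e → ends-only s b w (S.adjacent⇒~ {s} {w} e)
    ; edge-subdivided   = λ {x} {y} e → let open CommonNeighbour (edge-subdivided {x} {y} (H.adjacent⇒~ e))
                                        in vertex , S.~⇒adjacent ι₁~ , S.~⇒adjacent ι₂~
    ; no-square         = λ {s} {t} {a} {b} bs bt s≢t a≢b sa sb ta tb →
                            no-square {s} {t} {a} {b} bs bt s≢t a≢b (S.adjacent⇒~ sa) (S.adjacent⇒~ sb)
                                                    (S.adjacent⇒~ ta) (S.adjacent⇒~ tb)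
    }

IsLeast : (ℕ → Set) → ℕ → Set
IsLeast P d = P d × (∀ d′ → d′ < d → ¬ P d′)

IsLeast-unique : ∀ {P d e} → IsLeast P d → IsLeast P e → d ≡ e
IsLeast-unique (pd , below-d) (pe , below-e) =
  ≤-antisym (≮⇒≥ λ e<d → below-d _ e<d pe) (≮⇒≥ λ d<e → below-e _ d<e pd)

IsLeast-cong : ∀ {P Q} → (∀ d → P d → Q d) → (∀ d → Q d → P d) → ∀ d → IsLeast P d ⇔ IsLeast Q d
IsLeast-cong P⇒Q Q⇒P d = mk⇔ (λ (p , below) → P⇒Q d p , λ d′ lt q → below d′ lt (Q⇒P d′ q))
                             (λ (q , below) → Q⇒P d q , λ d′ lt p → below d′ lt (P⇒Q d′ p))

IsLeast-common : ∀ {P Q d₀} → IsLeast P d₀ → IsLeast Q d₀ → ∀ d → IsLeast P d ⇔ IsLeast Q d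
IsLeast-common p q d = mk⇔ (λ pd → subst (IsLeast _) (IsLeast-unique p pd) q)
                           (λ qd → subst (IsLeast _) (IsLeast-unique q qd) p)

IsLeast-2 : ∀ {P} → P 2 → ¬ P 0 → ¬ P 1 → IsLeast P 2
IsLeast-2 p2 ¬p0 ¬p1 = p2 , λ where
  zero          _              → ¬p0
  (suc zero)    _              → ¬p1
  (suc (suc _)) (s≤s (s≤s ()))

IsLeast-transfer-2 : ∀ {P Q} → (∀ d → P d → Q d) → P 2 → ¬ Q 0 → ¬ Q 1 → ∀ d → IsLeast P d ⇔ IsLeast Q d
IsLeast-transfer-2 P⇒Q p2 ¬q0 ¬q1 =
  IsLeast-common (IsLeast-2 p2 (λ p → ¬q0 (P⇒Q 0 p)) (λ p → ¬q1 (P⇒Q 1 p))) (IsLeast-2 (P⇒Q 2 p2) ¬q0 ¬q1)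

no-total-labeling-0 : ∀ {H} → V H → ¬ HasTotalDistinguishingLabeling H 0
no-total-labeling-0 x (cV , _) with cV x
... | ()

module _ {n : ℕ} (G : SimpleGraph (suc n)) (cG : Connected G) (k : ℕ) where

  open Halving (Halving-of-subdivision.halving G (suc k))
  open Subdivision G using (DegreeTwoᴳ; module Proper)
  open Proper (2 * suc k) (≤-trans (s≤s z≤n) (m≤n+m _ k))
    using (DegreeTwoᴳ⇒DegreeTwo; DegreeTwo⇒DegreeTwoᴳ; internal-DegreeTwo; connected)

  x₀ : V (subdivision (suc k) G)
  x₀ = inj₁ zero

  cycle-case : (∀ v → DegreeTwoᴳ v) → ∀ d →
    IsDistinguishingNumber (subdivision (2 * suc k) G) d ⇔ IsTotalDistinguishingNumber (subdivision (suc k) G) d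
  cycle-case all-two = IsLeast-transfer-2 (λ _ → distinguishing⇒total x₀) two-labels (no-total-labeling-0 x₀) no-total-1
    where
    degree-two : ∀ s → DegreeTwo s
    degree-two (inj₁ v) = DegreeTwoᴳ⇒DegreeTwo v (all-two v)
    degree-two (inj₂ s) = internal-DegreeTwo s
    open Cycle degree-two (connected cG) x₀

  non-cycle-case : ∀ v → ¬ DegreeTwoᴳ v → ∀ d →
    IsDistinguishingNumber (subdivision (2 * suc k) G) d ⇔ IsTotalDistinguishingNumber (subdivision (suc k) G) d
  non-cycle-case v ¬two = IsLeast-cong (λ _ → distinguishing⇒total x₀) (λ _ → total⇒distinguishing branch-kept)
    where
    branch-kept : ∀ ψ → BranchPreserving ψ
    branch-kept = branch-preserved (inj₁ v) (λ two → ¬two (DegreeTwo⇒DegreeTwoᴳ v two)) (connected cG)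

-- The hypothesis n ≥ 3 only serves to provide a vertex: a connected graph all of
-- whose vertices have degree two is automatically a cycle.
theorem3p6 : ∀ (n : ℕ) (G : SimpleGraph n) → 3 ≤ n → Connected G →
    ∀ (k : ℕ) → 1 ≤ k → ∀ (d : ℕ) →
    IsDistinguishingNumber (subdivision (2 * k) G) d ⇔ IsTotalDistinguishingNumber (subdivision k G) d
theorem3p6 (suc n) G _ cG (suc k) _ with all? (Subdivision.degreeTwoᴳ? G)
... | yes all-two = cycle-case G cG k all-two
... | no ¬all-two with ¬∀⟶∃¬ _ _ (Subdivision.degreeTwoᴳ? G) ¬all-two
...   | v , ¬two = non-cycle-case G cG k v ¬two
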